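{- Let $G$ be a $2$-vertex-connected graph (multiple edges allowed) with $r$ vertices, of which $r-1$ have degree $3$ and one has degree $r+1$. Then $G$ is the planar dual of a $2$-tree.
   Context: A $2$-tree is a graph obtained from a triangle $K_3$ by repeatedly adding a new vertex and joining it to both ends of an existing edge. "$G$ is the planar dual of $T$" means $T$ is planar with a plane embedding whose geometric dual is $G$. -}

module Defs where

open import Data.Nat using (ℕ; zero; suc; _+_)
open import Data.Bool using (Bool; true; false; not)
open import Data.Fin using (Fin; inject₁; fromℕ; splitAt; _≟_)
open import Data.Fin.Patterns using (0F; 1F; 2F)
open import Data.List using (map)
open import Data.Nat.ListAction using (sum)
open import Data.List using () renaming (allFin to allFinL)
open import Data.Product using (Σ; ∃; ∃-syntax; _×_; _,_; proj₁; proj₂)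
open import Data.Sum using (_⊎_; inj₁; inj₂)
open import Relation.Nullary using (¬_; yes; no)
open import Relation.Binary.PropositionalEquality using (_≡_; _≢_)
open import Relation.Binary.Construct.Closure.ReflexiveTransitive using (Star)
open import Function.Bundles using (_↔_; Inverse)

record MGraph : Set where
  constructor mgraph
  field
    V    : ℕ
    E    : ℕ
    ends : Fin E → Fin V × Fin V
open MGraph public

Loopless : MGraph → Set
Loopless G = ∀ e → proj₁ (ends G e) ≢ proj₂ (ends G e)

δ : ∀ {n} → Fin n → Fin n → ℕ
δ u v with u ≟ v
... | yes _ = 1
... | no  _ = 0

-- degree: number of edge-ends at v (a loop would count twice)
deg : (G : MGraph) → Fin (V G) → ℕ
deg G v = sum (map (λ e → δ v (proj₁ (ends G e)) + δ v (proj₂ (ends G e)))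
                   (allFinL (E G)))

Adj : (G : MGraph) → Fin (V G) → Fin (V G) → Set
Adj G u w = ∃[ e ] (ends G e ≡ (u , w) ⊎ ends G e ≡ (w , u))

Connected : MGraph → Set
Connected G = ∀ u w → Star (Adj G) u w

AdjAvoid : (G : MGraph) → Fin (V G) → Fin (V G) → Fin (V G) → Set
AdjAvoid G x u w = Adj G u w × u ≢ x × w ≢ x

ConnectedWithout : (G : MGraph) → Fin (V G) → Set
ConnectedWithout G x = ∀ u w → u ≢ x → w ≢ x → Star (AdjAvoid G x) u w

TwoConnected : MGraph → Set
TwoConnected G = (2 Data.Nat.≤ V G) × Connected G × (∀ x → ConnectedWithout G x)

K3 : MGraph
K3 = mgraph 3 3 f
  where
  f : Fin 3 → Fin 3 × Fin 3
  f 0F = 0F , 1F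
  f 1F = 1F , 2F
  f 2F = 0F , 2F

-- add a new vertex (index V) joined to both ends of edge e
-- (new edges get indices E and E+1)
addOn : (G : MGraph) → Fin (E G) → MGraph
addOn G e = mgraph (suc (V G)) (E G + 2) f
  where
  new : Fin (suc (V G))
  new = fromℕ (V G)
  f : Fin (E G + 2) → Fin (suc (V G)) × Fin (suc (V G))
  f i with splitAt (E G) i
  ... | inj₁ j  = inject₁ (proj₁ (ends G j)) , inject₁ (proj₂ (ends G j))
  ... | inj₂ 0F = inject₁ (proj₁ (ends G e)) , new
  ... | inj₂ 1F = inject₁ (proj₂ (ends G e)) , new

data TwoTree : MGraph → Set where
  triangle : TwoTree K3
  extend   : ∀ {G} → TwoTree G → (e : Fin (E G)) → TwoTree (addOn G e)

Dart : MGraph → Set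
Dart G = Fin (E G) × Bool

tail : (G : MGraph) → Dart G → Fin (V G)
tail G (e , true)  = proj₁ (ends G e)
tail G (e , false) = proj₂ (ends G e)

flipD : ∀ {G} → Dart G → Dart G
flipD (e , b) = e , not b

iter : ∀ {A : Set} → (A → A) → ℕ → A → A
iter f zero    x = x
iter f (suc k) x = f (iter f k x)

-- A 2-cell embedding of G in an orientable surface, given by a rotation
-- system σ (cyclic order of darts around each vertex), together with an
-- explicit enumeration of its faces (orbits of σ ∘ flip).
record Embedding (G : MGraph) : Set where
  field
    σ        : Dart G ↔ Dart G
    σ-tail   : ∀ d → tail G (Inverse.to σ d) ≡ tail G d
    σ-cyclic : ∀ d d' → tail G d ≡ tail G d' → ∃[ k ] iter (Inverse.to σ) k d ≡ d'
    F        : ℕ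
    face     : Dart G → Fin F
    face-orbit  : ∀ d d' → face d ≡ face d'
                    → ∃[ k ] iter (λ x → Inverse.to σ (flipD {G} x)) k d ≡ d'
    orbit-face  : ∀ d d' → (∃[ k ] iter (λ x → Inverse.to σ (flipD {G} x)) k d ≡ d')
                    → face d ≡ face d'
    face-onto   : ∀ f → ∃[ d ] face d ≡ f
open Embedding public

-- plane (genus 0) embedding of a connected graph: Euler's formula
IsPlane : (G : MGraph) → Embedding G → Set
IsPlane G M = V G + F M ≡ E G + 2

dual : (G : MGraph) → Embedding G → MGraph
dual G M = mgraph (F M) (E G) (λ e → face M (e , true) , face M (e , false))

Iso : MGraph → MGraph → Set
Iso G H = Σ (Fin (V G) ↔ Fin (V H)) λ f → Σ (Fin (E G) ↔ Fin (E H)) λ g →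
  ∀ e → let (a , b) = ends G e in
        ends H (Inverse.to g e) ≡ (Inverse.to f a , Inverse.to f b)
        ⊎ ends H (Inverse.to g e) ≡ (Inverse.to f b , Inverse.to f a)

IsPlanarDualOf : MGraph → MGraph → Set
IsPlanarDualOf G T = Σ (Embedding T) λ M → IsPlane T M × Iso (dual T M) G

module Submission where

-- Call G realizable if it is isomorphic to the dual of a plane embedding of
-- a loopless 2-tree.  We prove by induction on V that the hypotheses imply
-- realizability.
--   Base, V = 2: every edge joins c to the other vertex and there are three
--   of them, so G is the dual θ of the triangle K3.
--   Step, V ≥ 3: as ∑_v #(edges c—v) = deg c = V + 1 > V, some v is joined
--   to c twice; v has degree 3 and, since G - c is connected, its third
--   neighbour w is not c (a leaf).  Deleting v and rerouting its third edge
--   to c gives a smaller G′ with the same hypotheses, and G is obtained from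
--   G′ by subdivideDouble.  Dually subdivideDouble is adding a vertex on an
--   edge of the 2-tree, inside a face, so realizability passes from G′ to G.

open import Defs
open import Data.Nat using (ℕ; zero; suc; _+_; _*_; _∸_; _≤_; _<_; z≤n; s≤s)
open import Data.Nat.Properties
open import Data.Nat.ListAction using () renaming (sum to sumˡ)
open import Data.Bool using (Bool; true; false; not)
open import Data.Bool.Properties using (not-involutive) renaming (_≟_ to _≟B_)
open import Data.Fin as Fin using (Fin; zero; suc; inject₁; fromℕ; splitAt; join; _↑ˡ_; _↑ʳ_; cast)
open import Data.Fin.Properties
  using (splitAt-↑ˡ; splitAt-↑ʳ; join-splitAt; fromℕ≢inject₁; inject₁-injective; +↔⊎)
  renaming (suc-injective to fsuc-injective)
open import Data.Fin.Patterns using (0F; 1F; 2F)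
open import Data.List using (map; tabulate)
open import Data.List.Properties using (map-tabulate)
open import Data.Product using (Σ; ∃-syntax; _×_; _,_; proj₁; proj₂)
open import Data.Product.Properties using (≡-dec)
open import Data.Sum using (_⊎_; inj₁; inj₂; [_,_])
open import Data.Unit using (⊤; tt)
open import Data.Empty using (⊥; ⊥-elim)
open import Relation.Nullary using (yes; no; Dec)
open import Relation.Binary.PropositionalEquality hiding ([_])
open import Relation.Binary.Construct.Closure.ReflexiveTransitive using (Star; ε; _◅_; kleisliStar; return)
open import Function.Bundles using (_↔_; Inverse; mk↔ₛ′)
open import Function.Properties.Inverse using (↔-refl; ↔-sym; ↔-trans)
open import Data.Fin.Permutation using (transpose; cast-id)
open Inverse using (to; from)
open import Algebra.Properties.CommutativeMonoid.Sum +-0-commutativeMonoid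
  using (sum-syntax; sum-cong-≗; ∑-distrib-+; ∑-comm; ∑-permute; sum-replicate-zero)
open import Algebra.Properties.Semiring.Sum +-*-semiring using (*-distribˡ-sum)
open import Algebra.Properties.CommutativeSemigroup +-commutativeSemigroup using (interchange)

incidence : (G : MGraph) → Fin (V G) → Fin (E G) → ℕ
incidence G x e = δ x (proj₁ (ends G e)) + δ x (proj₂ (ends G e))

deg-∑ : (G : MGraph) (x : Fin (V G)) → deg G x ≡ ∑[ e < E G ] incidence G x e
deg-∑ G x = trans (cong sumˡ (map-tabulate (λ i → i) (incidence G x))) (sum-tabulate (E G) (incidence G x))
  where
  sum-tabulate : ∀ n (h : Fin n → ℕ) → sumˡ (tabulate h) ≡ ∑[ i < n ] h i
  sum-tabulate zero    h = refl
  sum-tabulate (suc n) h = cong (h zero +_) (sum-tabulate n (λ i → h (suc i)))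

δ-refl : ∀ {n} (a : Fin n) → δ a a ≡ 1
δ-refl a with a Fin.≟ a
... | yes _ = refl
... | no a≢a = ⊥-elim (a≢a refl)

δ-≢ : ∀ {n} {a b : Fin n} → a ≢ b → δ a b ≡ 0
δ-≢ {a = a} {b} a≢b with a Fin.≟ b
... | yes a≡b = ⊥-elim (a≢b a≡b)
... | no _    = refl

δ-cases : ∀ {n} (a b : Fin n) → (a ≡ b × δ a b ≡ 1) ⊎ (a ≢ b × δ a b ≡ 0)
δ-cases a b = by (a Fin.≟ b)
  where
  by : Dec (a ≡ b) → (a ≡ b × δ a b ≡ 1) ⊎ (a ≢ b × δ a b ≡ 0)
  by (yes refl) = inj₁ (refl , δ-refl a)
  by (no a≢b)   = inj₂ (a≢b , δ-≢ a≢b)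

δ-sym : ∀ {n} (a b : Fin n) → δ a b ≡ δ b a
δ-sym a b with δ-cases a b
... | inj₁ (refl , _) = refl
... | inj₂ (a≢b , d)  = trans d (sym (δ-≢ (λ b≡a → a≢b (sym b≡a))))

δ≤1 : ∀ {n} (a b : Fin n) → δ a b ≤ 1
δ≤1 a b with δ-cases a b
... | inj₁ (_ , d) = ≤-reflexive d
... | inj₂ (_ , d) = ≤-trans (≤-reflexive d) z≤n

δ-injective : ∀ {m n} (f : Fin m → Fin n) → (∀ {x y} → f x ≡ f y → x ≡ y) → ∀ a b → δ (f a) (f b) ≡ δ a b
δ-injective f f-inj a b with δ-cases a b
... | inj₁ (refl , d) = trans (δ-refl (f a)) (sym d)
... | inj₂ (a≢b , d)  = trans (δ-≢ (λ fa≡fb → a≢b (f-inj fa≡fb))) (sym d)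

∑-const-1 : ∀ n → ∑[ i < n ] 1 ≡ n
∑-const-1 zero    = refl
∑-const-1 (suc n) = cong suc (∑-const-1 n)

∑-δ : ∀ n (a : Fin n) → ∑[ i < n ] δ a i ≡ 1
∑-δ (suc n) zero = begin
  δ 0₊ 0₊ + ∑[ i < n ] δ 0₊ (suc i) ≡⟨ cong₂ _+_ (δ-refl 0₊) (sum-cong-≗ (λ i → δ-≢ {a = 0₊} {b = suc i} (λ ()))) ⟩
  1 + ∑[ i < n ] 0                  ≡⟨ cong suc (sum-replicate-zero n) ⟩
  1                                 ∎
  where
  open ≡-Reasoning
  0₊ : Fin (suc n)
  0₊ = zero
∑-δ (suc n) (suc a) = begin
  δ (suc a) zero + ∑[ i < n ] δ (suc a) (suc i) ≡⟨ cong₂ _+_ (δ-≢ {a = suc a} {b = zero} (λ ())) (sum-cong-≗ (δ-injective suc fsuc-injective a)) ⟩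
  ∑[ i < n ] δ a i                              ≡⟨ ∑-δ n a ⟩
  1                                             ∎
  where open ≡-Reasoning

∑-δ′ : ∀ n (a : Fin n) → ∑[ i < n ] δ i a ≡ 1
∑-δ′ n a = trans (sum-cong-≗ (λ i → δ-sym i a)) (∑-δ n a)

∑-mono-≤ : ∀ n {f g : Fin n → ℕ} → (∀ i → f i ≤ g i) → ∑[ i < n ] f i ≤ ∑[ i < n ] g i
∑-mono-≤ zero    f≤g = z≤n
∑-mono-≤ (suc n) f≤g = +-mono-≤ (f≤g zero) (∑-mono-≤ n (λ i → f≤g (suc i)))

∑-<-witness : ∀ n (f g : Fin n → ℕ) → ∑[ i < n ] g i < ∑[ i < n ] f i → ∃[ i ] g i < f i
∑-<-witness (suc n) f g ∑g<∑f with g zero <? f zero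
... | yes g0<f0 = zero , g0<f0
... | no  g0≮f0 with ∑-<-witness n (λ i → f (suc i)) (λ i → g (suc i))
                       (+-cancelˡ-< (g zero) _ _
                         (<-≤-trans ∑g<∑f (+-monoˡ-≤ (∑[ i < n ] f (suc i)) (≮⇒≥ g0≮f0))))
... | i , gi<fi = suc i , gi<fi

∑-split : ∀ m k (f : Fin (m + k) → ℕ) → ∑[ i < m + k ] f i ≡ ∑[ i < m ] f (i ↑ˡ k) + ∑[ i < k ] f (m ↑ʳ i)
∑-split zero    k f = refl
∑-split (suc m) k f = trans (cong (f zero +_) (∑-split m k (λ i → f (suc i)))) (sym (+-assoc (f zero) _ _))

module _ {A B : Set} (f : A ↔ B) where
  to-from : ∀ y → to f (from f y) ≡ y
  to-from = Inverse.strictlyInverseˡ f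

  from-to : ∀ x → from f (to f x) ≡ x
  from-to = Inverse.strictlyInverseʳ f

  to-injective : ∀ {x y} → to f x ≡ to f y → x ≡ y
  to-injective {x} {y} p = trans (sym (from-to x)) (trans (cong (from f) p) (from-to y))

mapPair : {A B : Set} → (A → B) → A × A → B × B
mapPair f (a , b) = f a , f b

swapPair : {A : Set} → A × A → A × A
swapPair (a , b) = b , a

_≈ᵤ_ : {A : Set} → A × A → A × A → Set
p ≈ᵤ q = p ≡ q ⊎ p ≡ swapPair q

≈ᵤ-sym : {A : Set} {p q : A × A} → p ≈ᵤ q → q ≈ᵤ p
≈ᵤ-sym (inj₁ refl) = inj₁ refl
≈ᵤ-sym {q = a , b} (inj₂ refl) = inj₂ refl

≈ᵤ-trans : {A : Set} {p q r : A × A} → p ≈ᵤ q → q ≈ᵤ r → p ≈ᵤ r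
≈ᵤ-trans (inj₁ refl) q≈r = q≈r
≈ᵤ-trans {r = a , b} (inj₂ refl) (inj₁ refl) = inj₂ refl
≈ᵤ-trans {r = a , b} (inj₂ refl) (inj₂ refl) = inj₁ refl

≈ᵤ-subst : {A : Set} {x x' y y' : A × A} → x ≡ x' → y ≡ y' → x ≈ᵤ y → x' ≈ᵤ y'
≈ᵤ-subst refl refl r = r

≈ᵤ-map : {A B : Set} (f : A → B) {p q : A × A} → p ≈ᵤ q → mapPair f p ≈ᵤ mapPair f q
≈ᵤ-map f (inj₁ refl) = inj₁ refl
≈ᵤ-map f {q = a , b} (inj₂ refl) = inj₂ refl

mapPair-∘ : {A B C : Set} (g : B → C) (f : A → B) (p : A × A) → mapPair g (mapPair f p) ≡ mapPair (λ x → g (f x)) p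
mapPair-∘ g f (a , b) = refl

mapPair-id : {A : Set} (f : A → A) → (∀ x → f x ≡ x) → (p : A × A) → mapPair f p ≡ p
mapPair-id f f≗id (a , b) = cong₂ _,_ (f≗id a) (f≗id b)

Isomorphic : MGraph → MGraph → Set
Isomorphic G H = Σ (Fin (V G) ↔ Fin (V H)) λ f → Σ (Fin (E G) ↔ Fin (E H)) λ g →
  ∀ e → ends H (to g e) ≈ᵤ mapPair (to f) (ends G e)

isomorphic⇒Iso : ∀ {G H} → Isomorphic G H → Iso G H
isomorphic⇒Iso {G} {H} (f , g , preserves) = f , g , λ e → unfold (ends G e) (preserves e)
  where
  unfold : ∀ {x} y → x ≈ᵤ mapPair (to f) y
         → x ≡ (to f (proj₁ y) , to f (proj₂ y)) ⊎ x ≡ (to f (proj₂ y) , to f (proj₁ y))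
  unfold (a , b) x≈y = x≈y

isomorphic-sym : ∀ {G H} → Isomorphic G H → Isomorphic H G
isomorphic-sym {G} {H} (f , g , preserves) = ↔-sym f , ↔-sym g , λ e′ → ≈ᵤ-sym (≈ᵤ-subst refl (back e′) (≈ᵤ-map from-f (image e′)))
  where
  from-f : Fin (V H) → Fin (V G)
  from-f = from f
  image : ∀ e′ → ends H e′ ≈ᵤ mapPair (to f) (ends G (from g e′))
  image e′ = subst (λ e″ → ends H e″ ≈ᵤ _) (to-from g e′) (preserves (from g e′))
  back : ∀ e′ → mapPair from-f (mapPair (to f) (ends G (from g e′))) ≡ ends G (from g e′)
  back e′ = trans (mapPair-∘ from-f (to f) _) (mapPair-id _ (from-to f) _)

isomorphic-trans : ∀ {G H K} → Isomorphic G H → Isomorphic H K → Isomorphic G K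
isomorphic-trans {G} {H} {K} (f₁ , g₁ , p₁) (f₂ , g₂ , p₂) = ↔-trans f₁ f₂ , ↔-trans g₁ g₂ , λ e →
  ≈ᵤ-trans (p₂ (to g₁ e)) (≈ᵤ-subst refl (mapPair-∘ (to f₂) (to f₁) (ends G e)) (≈ᵤ-map (to f₂) (p₁ e)))

Reach : {A : Set} → (A → A) → A → A → Set
Reach f x y = ∃[ k ] iter f k x ≡ y

iter-+ : {A : Set} (f : A → A) (m k : ℕ) (x : A) → iter f (m + k) x ≡ iter f m (iter f k x)
iter-+ f zero    k x = refl
iter-+ f (suc m) k x = cong f (iter-+ f m k x)

reach-refl : {A : Set} {f : A → A} {x : A} → Reach f x x
reach-refl = 0 , refl

reach-trans : {A : Set} {f : A → A} {x y z : A} → Reach f x y → Reach f y z → Reach f x z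
reach-trans {f = f} {x} (k₁ , p₁) (k₂ , p₂) = k₂ + k₁ , trans (iter-+ f k₂ k₁ x) (trans (cong (iter f k₂) p₁) p₂)

reach-step : {A : Set} {f : A → A} {x y : A} → f x ≡ y → Reach f x y
reach-step p = 1 , p

reach-snoc : {A : Set} {f : A → A} {x y z : A} → Reach f x y → f y ≡ z → Reach f x z
reach-snoc r p = reach-trans r (reach-step p)

iter-conj : {A B : Set} (h : A ↔ B) (f : A → A) (g : B → B)
  → (∀ x → f x ≡ from h (g (to h x)))
  → ∀ k x → iter f k x ≡ from h (iter g k (to h x))
iter-conj h f g f≡conj zero    x = sym (from-to h x)
iter-conj h f g f≡conj (suc k) x =
  trans (f≡conj _) (cong (λ y → from h (g y)) (trans (cong (to h) (iter-conj h f g f≡conj k x)) (to-from h _)))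

-- An embedding of G described on an arbitrary set W of "darts" in
-- bijection with Dart G; it transports to a genuine Embedding G.  This
-- lets the vertex-addition step work on the convenient set Dart T ⊎ Role.
record EmbeddingVia (G : MGraph) : Set₁ where
  field
    W         : Set
    h         : Dart G ↔ W
    tailW     : W → Fin (V G)
    flipW     : W → W
    tail-ok   : ∀ w → tail G (from h w) ≡ tailW w
    flip-ok   : ∀ d → to h (flipD {G} d) ≡ flipW (to h d)
    σW        : W ↔ W
    σW-tail   : ∀ w → tailW (to σW w) ≡ tailW w
    σW-cyclic : ∀ w w' → tailW w ≡ tailW w' → Reach (to σW) w w'
    FW        : ℕ
    faceW     : W → Fin FW
    faceW-orbit : ∀ w w' → faceW w ≡ faceW w' → Reach (λ x → to σW (flipW x)) w w'
    orbit-faceW : ∀ w w' → Reach (λ x → to σW (flipW x)) w w' → faceW w ≡ faceW w'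
    faceW-onto  : ∀ f → ∃[ w ] faceW w ≡ f

transportEmbedding : ∀ {G} → EmbeddingVia G → Embedding G
transportEmbedding {G} M = record
  { σ        = σG
  ; σ-tail   = λ d → trans (tail-ok _) (trans (σW-tail _) (trans (sym (tail-ok _)) (cong (tail G) (from-to h d))))
  ; σ-cyclic = λ d d' same →
      let (k , reach) = σW-cyclic (to h d) (to h d') (tails-agree d d' same) in
      k , trans (iter-conj h (to σG) (to σW) (λ _ → refl) k d) (trans (cong (from h) reach) (from-to h d'))
  ; F          = FW
  ; face       = λ d → faceW (to h d)
  ; face-orbit = λ d d' same → let (k , reach) = faceW-orbit _ _ same in
      k , trans (iter-conj h φG φW φ-conj k d) (trans (cong (from h) reach) (from-to h d'))
  ; orbit-face = λ d d' (k , reach) → orbit-faceW _ _ (k ,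
      trans (sym (to-from h _)) (cong (to h) (trans (sym (iter-conj h φG φW φ-conj k d)) reach)))
  ; face-onto  = λ f → let (w , p) = faceW-onto f in from h w , trans (cong faceW (to-from h w)) p
  }
  where
  open EmbeddingVia M
  σG : Dart G ↔ Dart G
  σG = ↔-trans h (↔-trans σW (↔-sym h))
  tails-agree : ∀ d d' → tail G d ≡ tail G d' → tailW (to h d) ≡ tailW (to h d')
  tails-agree d d' same = trans (sym (tail-ok _)) (trans (cong (tail G) (from-to h d))
                            (trans same (trans (cong (tail G) (sym (from-to h d'))) (tail-ok _))))
  φG : Dart G → Dart G
  φG x = to σG (flipD {G} x)
  φW : W → W
  φW x = to σW (flipW x)
  φ-conj : ∀ x → φG x ≡ from h (φW (to h x))
  φ-conj x = cong (λ z → from h (to σW z)) (flip-ok x)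

-- Bijections extend to such enlargements fixing the added elements; this
-- is how isomorphisms are carried across one step of the construction.

inject₁-or-last : ∀ {n} (i : Fin (suc n)) → (∃[ j ] i ≡ inject₁ j) ⊎ i ≡ fromℕ n
inject₁-or-last {zero}  zero    = inj₂ refl
inject₁-or-last {suc n} zero    = inj₁ (zero , refl)
inject₁-or-last {suc n} (suc i) with inject₁-or-last i
... | inj₁ (j , i≡j) = inj₁ (suc j , cong suc i≡j)
... | inj₂ i≡last    = inj₂ (cong suc i≡last)

viewLast : ∀ {m} → Fin (suc m) → Fin m ⊎ ⊤
viewLast {zero}  zero    = inj₂ tt
viewLast {suc m} zero    = inj₁ zero
viewLast {suc m} (suc i) = Data.Sum.map suc (λ t → t) (viewLast i)

unviewLast : ∀ {m} → Fin m ⊎ ⊤ → Fin (suc m)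
unviewLast (inj₁ j)     = inject₁ j
unviewLast {m} (inj₂ _) = fromℕ m

viewLast-inject₁ : ∀ {m} (j : Fin m) → viewLast (inject₁ j) ≡ inj₁ j
viewLast-inject₁ {suc m} zero    = refl
viewLast-inject₁ {suc m} (suc j) rewrite viewLast-inject₁ j = refl

viewLast-last : ∀ m → viewLast (fromℕ m) ≡ inj₂ tt
viewLast-last zero    = refl
viewLast-last (suc m) rewrite viewLast-last m = refl

lastView : ∀ {m} → Fin (suc m) ↔ (Fin m ⊎ ⊤)
lastView {m} = mk↔ₛ′ viewLast unviewLast view-unview unview-view
  where
  view-unview : ∀ x → viewLast (unviewLast x) ≡ x
  view-unview (inj₁ j)  = viewLast-inject₁ j
  view-unview (inj₂ tt) = viewLast-last m
  unview-view : ∀ i → unviewLast (viewLast i) ≡ i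
  unview-view i with inject₁-or-last i
  ... | inj₁ (j , refl) = cong unviewLast (viewLast-inject₁ j)
  ... | inj₂ refl       = cong unviewLast (viewLast-last m)

⊎-mapˡ-↔ : {A B C : Set} → A ↔ B → (A ⊎ C) ↔ (B ⊎ C)
⊎-mapˡ-↔ f = mk↔ₛ′ (Data.Sum.map (to f) (λ c → c)) (Data.Sum.map (from f) (λ c → c))
  (λ { (inj₁ b) → cong inj₁ (to-from f b) ; (inj₂ c) → refl })
  (λ { (inj₁ a) → cong inj₁ (from-to f a) ; (inj₂ c) → refl })

extendLast : ∀ {m n} → Fin m ↔ Fin n → Fin (suc m) ↔ Fin (suc n)
extendLast f = ↔-trans lastView (↔-trans (⊎-mapˡ-↔ f) (↔-sym lastView))

extendLast-inject₁ : ∀ {m n} (f : Fin m ↔ Fin n) (j : Fin m) → to (extendLast f) (inject₁ j) ≡ inject₁ (to f j)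
extendLast-inject₁ f j rewrite viewLast-inject₁ j = refl

extendLast-last : ∀ {m n} (f : Fin m ↔ Fin n) → to (extendLast f) (fromℕ m) ≡ fromℕ n
extendLast-last {m} f rewrite viewLast-last m = refl

extendEdges : ∀ {m n} → Fin m ↔ Fin n → Fin (m + 2) ↔ Fin (n + 2)
extendEdges {m} {n} g = ↔-trans (+↔⊎ {m} {2}) (↔-trans (⊎-mapˡ-↔ g) (↔-sym (+↔⊎ {n} {2})))

extendEdges-old : ∀ {m n} (g : Fin m ↔ Fin n) i → to (extendEdges g) (i ↑ˡ 2) ≡ to g i ↑ˡ 2
extendEdges-old {m} g i rewrite splitAt-↑ˡ m i 2 = refl

extendEdges-new : ∀ {m n} (g : Fin m ↔ Fin n) k → to (extendEdges g) (m ↑ʳ k) ≡ n ↑ʳ k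
extendEdges-new {m} g k rewrite splitAt-↑ʳ m 2 k = refl

transpose-left : ∀ {n} (i j : Fin n) → to (transpose i j) i ≡ j
transpose-left i j with i Fin.≟ i
... | yes _  = refl
... | no i≢i = ⊥-elim (i≢i refl)

transpose-other : ∀ {n} (i j k : Fin n) → k ≢ i → k ≢ j → to (transpose i j) k ≡ k
transpose-other i j k k≢i k≢j with k Fin.≟ i
... | yes k≡i = ⊥-elim (k≢i k≡i)
... | no _ with k Fin.≟ j
...   | yes k≡j = ⊥-elim (k≢j k≡j)
...   | no _    = refl

addOn-old-edge : ∀ T e i → ends (addOn T e) (i ↑ˡ 2) ≡ (inject₁ (proj₁ (ends T i)) , inject₁ (proj₂ (ends T i)))
addOn-old-edge T e i rewrite splitAt-↑ˡ (E T) i 2 = refl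

addOn-new-edge₀ : ∀ T e → ends (addOn T e) (E T ↑ʳ 0F) ≡ (inject₁ (proj₁ (ends T e)) , fromℕ (V T))
addOn-new-edge₀ T e rewrite splitAt-↑ʳ (E T) 2 0F = refl

addOn-new-edge₁ : ∀ T e → ends (addOn T e) (E T ↑ʳ 1F) ≡ (inject₁ (proj₂ (ends T e)) , fromℕ (V T))
addOn-new-edge₁ T e rewrite splitAt-↑ʳ (E T) 2 1F = refl

addOn-loopless : ∀ T e → Loopless T → Loopless (addOn T e)
addOn-loopless T e loopless i = help (splitAt (E T) i) (join-splitAt (E T) 2 i)
  where
  help : ∀ v → join (E T) 2 v ≡ i → proj₁ (ends (addOn T e) i) ≢ proj₂ (ends (addOn T e) i)
  help (inj₁ j) refl eq rewrite addOn-old-edge T e j = loopless j (inject₁-injective eq)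
  help (inj₂ 0F) refl eq rewrite addOn-new-edge₀ T e = fromℕ≢inject₁ (sym eq)
  help (inj₂ 1F) refl eq rewrite addOn-new-edge₁ T e = fromℕ≢inject₁ (sym eq)


-- Dual operation of adding a vertex on edge e of a 2-tree: in the dual G,
-- edge j = {a , b} (a its s-end) is rerouted to {n , b} for a new vertex n,
-- and two parallel edges a—n are added.  So n has degree 3 and a gains 1.

endAt : {A : Set} → Bool → A × A → A
endAt true (a , b) = a
endAt false (a , b) = b

setEnd : {A : Set} → Bool → A → A × A → A × A
setEnd true v (a , b) = v , b
setEnd false v (a , b) = a , v

digonEnds : {A : Set} → A → A → Fin 2 → A × A
digonEnds a n 0F = a , n
digonEnds a n 1F = n , a

subdivideEnds₁ : (G : MGraph) → (j : Fin (E G)) → Bool → (i : Fin (E G)) → Dec (i ≡ j) → Fin (suc (V G)) × Fin (suc (V G))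
subdivideEnds₁ G j s i (yes _) = setEnd s (fromℕ (V G)) (mapPair inject₁ (ends G j))
subdivideEnds₁ G j s i (no _) = mapPair inject₁ (ends G i)

subdivideEnds : (G : MGraph) → Fin (E G) → Bool → Fin (E G) ⊎ Fin 2 → Fin (suc (V G)) × Fin (suc (V G))
subdivideEnds G j s (inj₁ i) = subdivideEnds₁ G j s i (i Fin.≟ j)
subdivideEnds G j s (inj₂ k) = digonEnds (inject₁ (endAt s (ends G j))) (fromℕ (V G)) k

subdivideDouble : (G : MGraph) → Fin (E G) → Bool → MGraph
subdivideDouble G j s = mgraph (suc (V G)) (E G + 2) (λ i → subdivideEnds G j s (splitAt (E G) i))

subdivideDouble-split : ∀ G j s → ends (subdivideDouble G j s) (j ↑ˡ 2) ≡ setEnd s (fromℕ (V G)) (mapPair inject₁ (ends G j))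
subdivideDouble-split G j s rewrite splitAt-↑ˡ (E G) j 2 with j Fin.≟ j
... | yes _ = refl
... | no ne = ⊥-elim (ne refl)

subdivideDouble-other : ∀ G j s i → i ≢ j → ends (subdivideDouble G j s) (i ↑ˡ 2) ≡ mapPair inject₁ (ends G i)
subdivideDouble-other G j s i ne rewrite splitAt-↑ˡ (E G) i 2 with i Fin.≟ j
... | yes eq = ⊥-elim (ne eq)
... | no _ = refl

subdivideDouble-new : ∀ G j s k → ends (subdivideDouble G j s) (E G ↑ʳ k) ≡ subdivideEnds G j s (inj₂ k)
subdivideDouble-new G j s k rewrite splitAt-↑ʳ (E G) 2 k = refl

-- The four darts of the two new edges of addOn T e, named relative to the
-- dart (e , s) whose tail is x and head y: Xo / Xi are the darts of the new
-- edge x—n at x / at n, and Yo / Yi those of the new edge y—n.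

data Role : Set where
  Xo Xi Yo Yi : Role

-- The new edge of addOn T e at the s-end of e (new edge 0F starts at the
-- first end of e).
newEdgeAt : Bool → Fin 2
newEdgeAt true = 0F
newEdgeAt false = 1F

roleOf : Bool → Fin 2 → Bool → Role
roleOf true 0F true = Xo
roleOf true 0F false = Xi
roleOf true 1F true = Yo
roleOf true 1F false = Yi
roleOf false 0F true = Yo
roleOf false 0F false = Yi
roleOf false 1F true = Xo
roleOf false 1F false = Xi

roleEdge : Bool → Role → Fin 2
roleEdge s Xo = newEdgeAt s
roleEdge s Xi = newEdgeAt s
roleEdge s Yo = newEdgeAt (not s)
roleEdge s Yi = newEdgeAt (not s)

roleSide : Role → Bool
roleSide Xo = true
roleSide Yo = true
roleSide Xi = false
roleSide Yi = false

flipRole : Role → Role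
flipRole Xo = Xi
flipRole Xi = Xo
flipRole Yo = Yi
flipRole Yi = Yo

roleOf-roleEdge : ∀ s r → roleOf s (roleEdge s r) (roleSide r) ≡ r
roleOf-roleEdge true Xo = refl
roleOf-roleEdge true Xi = refl
roleOf-roleEdge true Yo = refl
roleOf-roleEdge true Yi = refl
roleOf-roleEdge false Xo = refl
roleOf-roleEdge false Xi = refl
roleOf-roleEdge false Yo = refl
roleOf-roleEdge false Yi = refl

roleEdge-roleOf : ∀ s k b → (roleEdge s (roleOf s k b) , roleSide (roleOf s k b)) ≡ (k , b)
roleEdge-roleOf true 0F true = refl
roleEdge-roleOf true 0F false = refl
roleEdge-roleOf true 1F true = refl
roleEdge-roleOf true 1F false = refl
roleEdge-roleOf false 0F true = refl
roleEdge-roleOf false 0F false = refl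
roleEdge-roleOf false 1F true = refl
roleEdge-roleOf false 1F false = refl

roleOf-not : ∀ s k b → roleOf s k (not b) ≡ flipRole (roleOf s k b)
roleOf-not true 0F true = refl
roleOf-not true 0F false = refl
roleOf-not true 1F true = refl
roleOf-not true 1F false = refl
roleOf-not false 0F true = refl
roleOf-not false 0F false = refl
roleOf-not false 1F true = refl
roleOf-not false 1F false = refl

flip-flip : ∀ {G} (d : Dart G) → flipD {G} (flipD {G} d) ≡ d
flip-flip (i , b) = cong (i ,_) (not-involutive b)

tailRole : (T : MGraph) → Fin (E T) → Bool → Role → Fin (suc (V T))
tailRole T e s Xo = inject₁ (tail T (e , s))
tailRole T e s Yo = inject₁ (tail T (flipD {T} (e , s)))
tailRole T e s Xi = fromℕ (V T)
tailRole T e s Yi = fromℕ (V T)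

tail-role : ∀ T e s r → tail (addOn T e) (E T ↑ʳ roleEdge s r , roleSide r) ≡ tailRole T e s r
tail-role T e true Xo rewrite addOn-new-edge₀ T e = refl
tail-role T e true Xi rewrite addOn-new-edge₀ T e = refl
tail-role T e true Yo rewrite addOn-new-edge₁ T e = refl
tail-role T e true Yi rewrite addOn-new-edge₁ T e = refl
tail-role T e false Xo rewrite addOn-new-edge₁ T e = refl
tail-role T e false Xi rewrite addOn-new-edge₁ T e = refl
tail-role T e false Yo rewrite addOn-new-edge₀ T e = refl
tail-role T e false Yi rewrite addOn-new-edge₀ T e = refl

tails-differ : ∀ T → Loopless T → ∀ e s → tail T (e , s) ≢ tail T (flipD {T} (e , s))
tails-differ T loopless e true = loopless e
tails-differ T loopless e false = λ eq → loopless e (sym eq)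

-- Adding a vertex n on edge e of an embedded loopless T, inside the face f
-- to the left of the dart dx = (e , s).  In the rotation system, Xo is put
-- just before dx at x, Yo just after dy = flip dx at y, and n sees Xi, Yi.
-- Faces: f splits into the new triangle (dx , Yo , Xi) and the rest of f
-- (which now runs through Xo and Yi); all other faces are unchanged.
module AddVertex (T : MGraph) (M : Embedding T) (loopless : Loopless T) (e : Fin (E T)) (s : Bool) where

  T⁺ : MGraph
  T⁺ = addOn T e

  _≟D_ : (a b : Dart T) → Dec (a ≡ b)
  _≟D_ = ≡-dec Fin._≟_ _≟B_

  σf : Dart T → Dart T
  σf = to (σ M)
  σi : Dart T → Dart T
  σi = from (σ M)

  fl : Dart T → Dart T
  fl = flipD {T}

  -- dx = (e , s) runs from x to y and dy is its reverse; u = σ⁻¹ dx is the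
  -- dart before dx at x.  Along the face permutation φ = σ ∘ flip, the face
  -- of dx reads p → dx → q.
  dx : Dart T
  dx = e , s
  dy : Dart T
  dy = fl dx
  u : Dart T
  u = σi dx
  p : Dart T
  p = fl u
  q : Dart T
  q = σf dy
  x : Fin (V T)
  x = tail T dx
  y : Fin (V T)
  y = tail T dy

  φ : Dart T → Dart T
  φ d = σf (fl d)

  x≢y : x ≢ y
  x≢y = tails-differ T loopless e s

  tail-u : tail T u ≡ x
  tail-u = trans (sym (σ-tail M u)) (cong (tail T) (to-from (σ M) dx))

  u≢dy : u ≢ dy
  u≢dy eq = x≢y (trans (sym tail-u) (cong (tail T) eq))

  σu : σf u ≡ dx
  σu = to-from (σ M) dx

  σf-injective : ∀ {a b} → σf a ≡ σf b → a ≡ b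
  σf-injective = to-injective (σ M)

  fl-injective : ∀ {a b} → fl a ≡ fl b → a ≡ b
  fl-injective {a} {b} eq = trans (sym (flip-flip {T} a)) (trans (cong fl eq) (flip-flip {T} b))

  φ-injective : ∀ {a b} → φ a ≡ φ b → a ≡ b
  φ-injective eq = fl-injective (σf-injective eq)

  φp : φ p ≡ dx
  φp = trans (cong σf (flip-flip {T} u)) σu

  q≢dx : q ≢ dx
  q≢dx eq = x≢y (trans (cong (tail T) (sym eq)) (σ-tail M dy))

  p≢dx : p ≢ dx
  p≢dx eq = q≢dx (trans (cong φ (sym eq)) φp)

  W : Set
  W = Dart T ⊎ Role

  toW′ : Fin (E T) ⊎ Fin 2 → Bool → W
  toW′ (inj₁ j) b = inj₁ (j , b)
  toW′ (inj₂ k) b = inj₂ (roleOf s k b)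

  toW : Dart T⁺ → W
  toW (i , b) = toW′ (splitAt (E T) i) b

  fromW : W → Dart T⁺
  fromW (inj₁ (j , b)) = (j ↑ˡ 2 , b)
  fromW (inj₂ r) = (E T ↑ʳ roleEdge s r , roleSide r)

  fromW-toW′ : ∀ v b → fromW (toW′ v b) ≡ (join (E T) 2 v , b)
  fromW-toW′ (inj₁ j) b = refl
  fromW-toW′ (inj₂ k) b = cong (λ (kb : Fin 2 × Bool) → (E T ↑ʳ proj₁ kb , proj₂ kb)) (roleEdge-roleOf s k b)

  h : Dart T⁺ ↔ W
  h = mk↔ₛ′ toW fromW toW-fromW fromW-toW
    where
    toW-fromW : ∀ w → toW (fromW w) ≡ w
    toW-fromW (inj₁ (j , b)) rewrite splitAt-↑ˡ (E T) j 2 = refl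
    toW-fromW (inj₂ r) rewrite splitAt-↑ʳ (E T) 2 (roleEdge s r) = cong inj₂ (roleOf-roleEdge s r)
    fromW-toW : ∀ d → fromW (toW d) ≡ d
    fromW-toW (i , b) = trans (fromW-toW′ (splitAt (E T) i) b) (cong (_, b) (join-splitAt (E T) 2 i))

  tailW : W → Fin (suc (V T))
  tailW (inj₁ d) = inject₁ (tail T d)
  tailW (inj₂ r) = tailRole T e s r

  tail-ok : ∀ w → tail T⁺ (fromW w) ≡ tailW w
  tail-ok (inj₁ (j , true)) rewrite addOn-old-edge T e j = refl
  tail-ok (inj₁ (j , false)) rewrite addOn-old-edge T e j = refl
  tail-ok (inj₂ r) = tail-role T e s r

  flipW : W → W
  flipW (inj₁ d) = inj₁ (fl d)
  flipW (inj₂ r) = inj₂ (flipRole r)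

  flip-ok′ : ∀ v b → toW′ v (not b) ≡ flipW (toW′ v b)
  flip-ok′ (inj₁ j) b = refl
  flip-ok′ (inj₂ k) b = cong inj₂ (roleOf-not s k b)

  flip-ok : ∀ d → toW (flipD {T⁺} d) ≡ flipW (toW d)
  flip-ok (i , b) = flip-ok′ (splitAt (E T) i) b

  toσ₁ : (d : Dart T) → Dec (d ≡ u) → Dec (d ≡ dy) → W
  toσ₁ d (yes _) _ = inj₂ Xo
  toσ₁ d (no _) (yes _) = inj₂ Yo
  toσ₁ d (no _) (no _) = inj₁ (σf d)

  toσ : W → W
  toσ (inj₁ d) = toσ₁ d (d ≟D u) (d ≟D dy)
  toσ (inj₂ Xo) = inj₁ (σf u)
  toσ (inj₂ Yo) = inj₁ (σf dy)
  toσ (inj₂ Xi) = inj₂ Yi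
  toσ (inj₂ Yi) = inj₂ Xi

  fromσ₁ : (d : Dart T) → Dec (d ≡ σf u) → Dec (d ≡ σf dy) → W
  fromσ₁ d (yes _) _ = inj₂ Xo
  fromσ₁ d (no _) (yes _) = inj₂ Yo
  fromσ₁ d (no _) (no _) = inj₁ (σi d)

  fromσ : W → W
  fromσ (inj₁ d) = fromσ₁ d (d ≟D σf u) (d ≟D σf dy)
  fromσ (inj₂ Xo) = inj₁ u
  fromσ (inj₂ Yo) = inj₁ dy
  fromσ (inj₂ Xi) = inj₂ Yi
  fromσ (inj₂ Yi) = inj₂ Xi

  toσ-u : toσ (inj₁ u) ≡ inj₂ Xo
  toσ-u with u ≟D u
  ... | yes _ = refl
  ... | no ne = ⊥-elim (ne refl)

  toσ-dy : toσ (inj₁ dy) ≡ inj₂ Yo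
  toσ-dy with dy ≟D u
  ... | yes eq = ⊥-elim (u≢dy (sym eq))
  ... | no _ with dy ≟D dy
  ...   | yes _ = refl
  ...   | no ne = ⊥-elim (ne refl)

  toσ-o : ∀ d → d ≢ u → d ≢ dy → toσ (inj₁ d) ≡ inj₁ (σf d)
  toσ-o d n1 n2 with d ≟D u
  ... | yes eq = ⊥-elim (n1 eq)
  ... | no _ with d ≟D dy
  ...   | yes eq = ⊥-elim (n2 eq)
  ...   | no _ = refl

  σu≢σdy : σf u ≢ σf dy
  σu≢σdy eq = u≢dy (σf-injective eq)

  fromσ-u : fromσ (inj₁ (σf u)) ≡ inj₂ Xo
  fromσ-u with σf u ≟D σf u
  ... | yes _ = refl
  ... | no ne = ⊥-elim (ne refl)

  fromσ-dy : fromσ (inj₁ (σf dy)) ≡ inj₂ Yo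
  fromσ-dy with σf dy ≟D σf u
  ... | yes eq = ⊥-elim (σu≢σdy (sym eq))
  ... | no _ with σf dy ≟D σf dy
  ...   | yes _ = refl
  ...   | no ne = ⊥-elim (ne refl)

  fromσ-o : ∀ d → d ≢ σf u → d ≢ σf dy → fromσ (inj₁ d) ≡ inj₁ (σi d)
  fromσ-o d n1 n2 with d ≟D σf u
  ... | yes eq = ⊥-elim (n1 eq)
  ... | no _ with d ≟D σf dy
  ...   | yes eq = ⊥-elim (n2 eq)
  ...   | no _ = refl

  toσ-fromσ : ∀ w → toσ (fromσ w) ≡ w
  toσ-fromσ (inj₁ d) with d ≟D σf u
  ... | yes refl = refl
  ... | no n1 with d ≟D σf dy
  ...   | yes refl = refl
  ...   | no n2 =
          trans (toσ-o (σi d) (λ eq → n1 (trans (sym (to-from (σ M) d)) (cong σf eq)))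
                               (λ eq → n2 (trans (sym (to-from (σ M) d)) (cong σf eq))))
                (cong inj₁ (to-from (σ M) d))
  toσ-fromσ (inj₂ Xo) = toσ-u
  toσ-fromσ (inj₂ Yo) = toσ-dy
  toσ-fromσ (inj₂ Xi) = refl
  toσ-fromσ (inj₂ Yi) = refl

  fromσ-toσ : ∀ w → fromσ (toσ w) ≡ w
  fromσ-toσ (inj₁ d) with d ≟D u
  ... | yes refl = refl
  ... | no n1 with d ≟D dy
  ...   | yes refl = refl
  ...   | no n2 =
          trans (fromσ-o (σf d) (λ eq → n1 (σf-injective eq)) (λ eq → n2 (σf-injective eq)))
                (cong inj₁ (from-to (σ M) d))
  fromσ-toσ (inj₂ Xo) = fromσ-u
  fromσ-toσ (inj₂ Yo) = fromσ-dy
  fromσ-toσ (inj₂ Xi) = refl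
  fromσ-toσ (inj₂ Yi) = refl

  σW : W ↔ W
  σW = mk↔ₛ′ toσ fromσ toσ-fromσ fromσ-toσ

  σW-tail : ∀ w → tailW (toσ w) ≡ tailW w
  σW-tail (inj₁ d) with d ≟D u
  ... | yes refl = cong inject₁ (sym tail-u)
  ... | no n1 with d ≟D dy
  ...   | yes refl = refl
  ...   | no n2 = cong inject₁ (σ-tail M d)
  σW-tail (inj₂ Xo) = cong inject₁ (trans (σ-tail M u) tail-u)
  σW-tail (inj₂ Yo) = cong inject₁ (σ-tail M dy)
  σW-tail (inj₂ Xi) = refl
  σW-tail (inj₂ Yi) = refl

  -- Each old rotation step is simulated by the new rotation, with a detour
  -- through Xo or Yo; hence the darts at an old vertex stay one cycle.
  σ-step-simulated : ∀ d → Reach toσ (inj₁ d) (inj₁ (σf d))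
  σ-step-simulated d with d ≟D u
  ... | yes refl = 2 , cong toσ toσ-u
  ... | no n1 with d ≟D dy
  ...   | yes refl = 2 , cong toσ toσ-dy
  ...   | no n2 = reach-step (toσ-o d n1 n2)

  σ-iter-simulated : ∀ k d → Reach toσ (inj₁ d) (inj₁ (iter σf k d))
  σ-iter-simulated zero d = reach-refl
  σ-iter-simulated (suc k) d = reach-trans (σ-iter-simulated k d) (σ-step-simulated (iter σf k d))

  old-darts-cyclic : ∀ d d' → tail T d ≡ tail T d' → Reach toσ (inj₁ d) (inj₁ d')
  old-darts-cyclic d d' eq with σ-cyclic M d d' eq
  ... | k , p' = subst (λ t → Reach toσ (inj₁ d) (inj₁ t)) p' (σ-iter-simulated k d)

  dart-cyclic : ∀ d w' → inject₁ (tail T d) ≡ tailW w' → Reach toσ (inj₁ d) w'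
  dart-cyclic d (inj₁ d') eq = old-darts-cyclic d d' (inject₁-injective eq)
  dart-cyclic d (inj₂ Xo) eq = reach-snoc (old-darts-cyclic d u (trans (inject₁-injective eq) (sym tail-u))) toσ-u
  dart-cyclic d (inj₂ Yo) eq = reach-snoc (old-darts-cyclic d dy (inject₁-injective eq)) toσ-dy
  dart-cyclic d (inj₂ Xi) eq = ⊥-elim (fromℕ≢inject₁ (sym eq))
  dart-cyclic d (inj₂ Yi) eq = ⊥-elim (fromℕ≢inject₁ (sym eq))

  σW-cyclic : ∀ w w' → tailW w ≡ tailW w' → Reach toσ w w'
  σW-cyclic (inj₁ d) w' eq = dart-cyclic d w' eq
  σW-cyclic (inj₂ Xo) w' eq = reach-trans (reach-step refl) (dart-cyclic (σf u) w' (trans (cong inject₁ (trans (σ-tail M u) tail-u)) eq))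
  σW-cyclic (inj₂ Yo) w' eq = reach-trans (reach-step refl) (dart-cyclic (σf dy) w' (trans (cong inject₁ (σ-tail M dy)) eq))
  σW-cyclic (inj₂ Xi) (inj₂ Xi) eq = reach-refl
  σW-cyclic (inj₂ Xi) (inj₂ Yi) eq = reach-step refl
  σW-cyclic (inj₂ Yi) (inj₂ Yi) eq = reach-refl
  σW-cyclic (inj₂ Yi) (inj₂ Xi) eq = reach-step refl
  σW-cyclic (inj₂ Xi) (inj₁ d) eq = ⊥-elim (fromℕ≢inject₁ eq)
  σW-cyclic (inj₂ Xi) (inj₂ Xo) eq = ⊥-elim (fromℕ≢inject₁ eq)
  σW-cyclic (inj₂ Xi) (inj₂ Yo) eq = ⊥-elim (fromℕ≢inject₁ eq)
  σW-cyclic (inj₂ Yi) (inj₁ d) eq = ⊥-elim (fromℕ≢inject₁ eq)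
  σW-cyclic (inj₂ Yi) (inj₂ Xo) eq = ⊥-elim (fromℕ≢inject₁ eq)
  σW-cyclic (inj₂ Yi) (inj₂ Yo) eq = ⊥-elim (fromℕ≢inject₁ eq)

  newF : Fin (suc (F M))
  newF = fromℕ (F M)

  faceW₁ : (d : Dart T) → Dec (d ≡ dx) → Fin (suc (F M))
  faceW₁ d (yes _) = newF
  faceW₁ d (no _) = inject₁ (face M d)

  faceW : W → Fin (suc (F M))
  faceW (inj₁ d) = faceW₁ d (d ≟D dx)
  faceW (inj₂ Xo) = inject₁ (face M dx)
  faceW (inj₂ Yi) = inject₁ (face M dx)
  faceW (inj₂ Yo) = newF
  faceW (inj₂ Xi) = newF

  faceW-dx : faceW (inj₁ dx) ≡ newF
  faceW-dx with dx ≟D dx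
  ... | yes _ = refl
  ... | no ne = ⊥-elim (ne refl)

  faceW-o : ∀ d → d ≢ dx → faceW (inj₁ d) ≡ inject₁ (face M d)
  faceW-o d ne with d ≟D dx
  ... | yes eq = ⊥-elim (ne eq)
  ... | no _ = refl

  φW : W → W
  φW w = toσ (flipW w)

  φW-p : φW (inj₁ p) ≡ inj₂ Xo
  φW-p = trans (cong (λ t → toσ (inj₁ t)) (flip-flip {T} u)) toσ-u

  φW-dx : φW (inj₁ dx) ≡ inj₂ Yo
  φW-dx = toσ-dy

  φW-o : ∀ d → d ≢ p → d ≢ dx → φW (inj₁ d) ≡ inj₁ (φ d)
  φW-o d n1 n2 = toσ-o (fl d) (λ eq → n1 (trans (sym (flip-flip {T} d)) (cong fl eq))) (λ eq → n2 (fl-injective eq))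

  φW-Xi : φW (inj₂ Xi) ≡ inj₁ dx
  φW-Xi = cong inj₁ σu

  face-p : face M p ≡ face M dx
  face-p = orbit-face M p dx (1 , φp)

  face-q : face M q ≡ face M dx
  face-q = sym (orbit-face M dx q (1 , refl))

  p-to-q : Reach φW (inj₁ p) (inj₁ q)
  p-to-q = 3 , cong (λ t → φW (φW t)) φW-p

  -- Following an old face orbit from d ≠ dx in the new map: an iterate
  -- other than dx is reached, and reaching dx means p was reached (the new
  -- map then goes p → Xo → Yi → q instead of through dx).
  φ-iter-simulated : ∀ d → d ≢ dx → ∀ k →
    (iter φ k d ≢ dx → Reach φW (inj₁ d) (inj₁ (iter φ k d))) ×
    (iter φ k d ≡ dx → Reach φW (inj₁ d) (inj₁ p))
  φ-iter-simulated d ne zero = (λ _ → reach-refl) , (λ eq → ⊥-elim (ne eq))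
  φ-iter-simulated d ne (suc k) with φ-iter-simulated d ne k | iter φ k d ≟D dx
  ... | A , B | yes eqy =
        (λ _ → subst (λ t → Reach φW (inj₁ d) (inj₁ t)) (cong φ (sym eqy)) (reach-trans (B eqy) p-to-q)) ,
        (λ eq' → ⊥-elim (q≢dx (trans (cong φ (sym eqy)) eq')))
  ... | A , B | no ney with iter φ k d ≟D p
  ...   | yes eqp = (λ ne' → ⊥-elim (ne' (trans (cong φ eqp) φp))) ,
                    (λ _ → subst (λ t → Reach φW (inj₁ d) (inj₁ t)) eqp (A ney))
  ...   | no nep = (λ _ → reach-snoc (A ney) (φW-o _ nep ney)) ,
                   (λ eq' → ⊥-elim (nep (φ-injective (trans eq' (sym φp)))))

  old-orbit-simulated : ∀ d d' → d ≢ dx → d' ≢ dx → Reach φ d d' → Reach φW (inj₁ d) (inj₁ d')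
  old-orbit-simulated d d' n1 n2 (k , eq) =
    subst (λ t → Reach φW (inj₁ d) (inj₁ t)) eq (proj₁ (φ-iter-simulated d n1 k) (λ e' → n2 (trans (sym eq) e')))

  record InOldFace (w : W) : Set where
    field
      a b : Dart T
      a≢ : a ≢ dx
      b≢ : b ≢ dx
      ra : Reach φW w (inj₁ a)
      rb : Reach φW (inj₁ b) w
      fa : faceW w ≡ inject₁ (face M a)
      fab : face M a ≡ face M b

  InNewFace : W → Set
  InNewFace w = Reach φW w (inj₁ dx) × Reach φW (inj₁ dx) w × faceW w ≡ newF

  classify : ∀ w → InNewFace w ⊎ InOldFace w
  classify (inj₁ d) with d ≟D dx
  ... | yes refl = inj₁ (reach-refl , reach-refl , refl)
  ... | no ne = inj₂ (record { a = d ; b = d ; a≢ = ne ; b≢ = ne ; ra = reach-refl ; rb = reach-refl ; fa = faceW-o d ne ; fab = refl })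
  classify (inj₂ Xo) = inj₂ (record { a = q ; b = p ; a≢ = q≢dx ; b≢ = p≢dx ; ra = 2 , refl ; rb = reach-step φW-p
                             ; fa = cong inject₁ (sym face-q) ; fab = trans face-q (sym face-p) })
  classify (inj₂ Yi) = inj₂ (record { a = q ; b = p ; a≢ = q≢dx ; b≢ = p≢dx ; ra = 1 , refl ; rb = 2 , cong φW φW-p
                             ; fa = cong inject₁ (sym face-q) ; fab = trans face-q (sym face-p) })
  classify (inj₂ Yo) = inj₁ ((2 , φW-Xi) , reach-step φW-dx , refl)
  classify (inj₂ Xi) = inj₁ (reach-step φW-Xi , (2 , cong φW φW-dx) , refl)

  faceW-orbit : ∀ w w' → faceW w ≡ faceW w' → Reach φW w w'
  faceW-orbit w w' eq with classify w | classify w'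
  ... | inj₁ (r1 , _ , f1) | inj₁ (_ , r2 , _) = reach-trans r1 r2
  ... | inj₁ (_ , _ , f1) | inj₂ o = ⊥-elim (fromℕ≢inject₁ (trans (sym f1) (trans eq (InOldFace.fa o))))
  ... | inj₂ o | inj₁ (_ , _ , f2) = ⊥-elim (fromℕ≢inject₁ (trans (sym f2) (trans (sym eq) (InOldFace.fa o))))
  ... | inj₂ o | inj₂ o' =
        let open InOldFace in
        let fe : face M (a o) ≡ face M (b o')
            fe = trans (inject₁-injective (trans (sym (fa o)) (trans eq (fa o')))) (fab o') in
        reach-trans (ra o) (reach-trans (old-orbit-simulated (a o) (b o') (a≢ o) (b≢ o') (face-orbit M (a o) (b o') fe)) (rb o'))

  faceW-φW : ∀ w → faceW (φW w) ≡ faceW w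
  faceW-φW (inj₁ d) with d ≟D dx
  ... | yes refl = cong faceW φW-dx
  ... | no ne with d ≟D p
  ...   | yes refl = trans (cong faceW φW-p) (cong inject₁ (sym face-p))
  ...   | no nep = trans (cong faceW (φW-o d nep ne))
                   (trans (faceW-o (φ d) (λ eq → nep (φ-injective (trans eq (sym φp)))))
                   (cong inject₁ (sym (orbit-face M d (φ d) (1 , refl)))))
  faceW-φW (inj₂ Xo) = refl
  faceW-φW (inj₂ Yi) = trans (faceW-o q q≢dx) (cong inject₁ face-q)
  faceW-φW (inj₂ Yo) = refl
  faceW-φW (inj₂ Xi) = trans (cong faceW φW-Xi) faceW-dx

  faceW-iterφW : ∀ k w → faceW (iter φW k w) ≡ faceW w
  faceW-iterφW zero w = refl
  faceW-iterφW (suc k) w = trans (faceW-φW (iter φW k w)) (faceW-iterφW k w)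

  orbit-faceW : ∀ w w' → Reach φW w w' → faceW w ≡ faceW w'
  orbit-faceW w w' (k , eq) = trans (sym (faceW-iterφW k w)) (cong faceW eq)

  faceW-onto : ∀ f → ∃[ w ] faceW w ≡ f
  faceW-onto f with inject₁-or-last f
  ... | inj₂ refl = inj₁ dx , faceW-dx
  ... | inj₁ (j , refl) with face-onto M j
  ...   | d , eq with d ≟D dx
  ...     | yes refl = inj₂ Xo , cong inject₁ eq
  ...     | no ne = inj₁ d , trans (faceW-o d ne) (cong inject₁ eq)

  embeddingVia : EmbeddingVia T⁺
  embeddingVia = record
    { W = W ; h = h ; tailW = tailW ; flipW = flipW ; tail-ok = tail-ok ; flip-ok = flip-ok
    ; σW = σW ; σW-tail = σW-tail ; σW-cyclic = σW-cyclic
    ; FW = suc (F M) ; faceW = faceW ; faceW-orbit = faceW-orbit ; orbit-faceW = orbit-faceW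
    ; faceW-onto = faceW-onto }

  M⁺ : Embedding T⁺
  M⁺ = transportEmbedding embeddingVia

  -- One more vertex, two more edges and one more face: Euler's formula holds.
  plane⁺ : IsPlane T M → IsPlane T⁺ M⁺
  plane⁺ pl = trans (cong suc (+-suc (V T) (F M))) (trans (cong (λ t → suc (suc t)) pl) (+-comm 2 (E T + 2)))

  toW-old : ∀ i b → toW (i ↑ˡ 2 , b) ≡ inj₁ (i , b)
  toW-old i b rewrite splitAt-↑ˡ (E T) i 2 = refl

  toW-new : ∀ k b → toW (E T ↑ʳ k , b) ≡ inj₂ (roleOf s k b)
  toW-new k b rewrite splitAt-↑ʳ (E T) 2 k = refl

Realizable : MGraph → Set
Realizable G = Σ MGraph λ T → TwoTree T × Loopless T × Σ (Embedding T) λ M → IsPlane T M × Isomorphic (dual T M) G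

chooseSide : {A : Set} (X : A × A) (a b : A) (sG : Bool) → X ≈ᵤ (a , b) →
  Σ Bool λ s → (endAt sG X ≡ endAt s (a , b)) × (endAt (not sG) X ≡ endAt (not s) (a , b))
chooseSide X a b sG    (inj₁ refl) = sG , refl , refl
chooseSide X a b true  (inj₂ refl) = false , refl , refl
chooseSide X a b false (inj₂ refl) = true , refl , refl

setEnd-≈ᵤ : {A : Set} (X : A × A) (sG s : Bool) (a b n : A)
  → endAt (not sG) X ≡ endAt (not s) (a , b) → setEnd sG n X ≈ᵤ setEnd s n (a , b)
setEnd-≈ᵤ (_ , _) true  true  a b n same = inj₁ (cong (n ,_) same)
setEnd-≈ᵤ (_ , _) true  false a b n same = inj₂ (cong (n ,_) same)
setEnd-≈ᵤ (_ , _) false true  a b n same = inj₂ (cong (_, n) same)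
setEnd-≈ᵤ (_ , _) false false a b n same = inj₁ (cong (_, n) same)

pair-setEnd : {X : Set} (s : Bool) (F G : Bool → X) (n : X) → F s ≡ n → F (not s) ≡ G (not s) →
  (F true , F false) ≡ setEnd s n (G true , G false)
pair-setEnd true  F G n at-s off-s = cong₂ _,_ at-s off-s
pair-setEnd false F G n at-s off-s = cong₂ _,_ off-s at-s

mapPair-setEnd : {A B : Set} (f : A → B) (s : Bool) (n : A) (P : A × A) → mapPair f (setEnd s n P) ≡ setEnd s (f n) (mapPair f P)
mapPair-setEnd f true  n (a , b) = refl
mapPair-setEnd f false n (a , b) = refl

endAt-mapPair : {A B : Set} (f : A → B) (s : Bool) (X : A × A) → endAt s (mapPair f X) ≡ f (endAt s X)
endAt-mapPair f true  (a , b) = refl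
endAt-mapPair f false (a , b) = refl

endAt-pair : {A : Set} (H : Bool → A) (s : Bool) → endAt s (H true , H false) ≡ H s
endAt-pair H true  = refl
endAt-pair H false = refl

roleFace : {A : Set} → A → A → Role → A
roleFace a n Xo = a
roleFace a n Yi = a
roleFace a n Yo = n
roleFace a n Xi = n

digon-≈ᵤ : {A : Set} (s : Bool) (k : Fin 2) (a n : A) →
  digonEnds a n k ≈ᵤ (roleFace a n (roleOf s k true) , roleFace a n (roleOf s k false))
digon-≈ᵤ true  0F a n = inj₁ refl
digon-≈ᵤ true  1F a n = inj₁ refl
digon-≈ᵤ false 0F a n = inj₂ refl
digon-≈ᵤ false 1F a n = inj₂ refl

-- If
-- G ≅ dual T M, edge j of G is the dual of an edge e of T; adding a vertex
-- on e inside the face dual to the sG-end of j realizes subdivideDouble G j sG.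
realizable-subdivideDouble : ∀ G → Realizable G → (j : Fin (E G)) (sG : Bool) → Realizable (subdivideDouble G j sG)
realizable-subdivideDouble G (T , twoTree , loopless , M , plane , (f , g , preserves)) j sG =
  addOn T e , extend twoTree e , addOn-loopless T e loopless , M⁺ , plane⁺ plane , extendLast f , extendEdges g , preserves⁺
  where
  e : Fin (E T)
  e = from g j
  ends-j : ends G j ≈ᵤ (to f (face M (e , true)) , to f (face M (e , false)))
  ends-j = subst (λ t → ends G t ≈ᵤ (to f (face M (e , true)) , to f (face M (e , false)))) (to-from g j) (preserves e)
  side : Σ Bool λ s → (endAt sG (ends G j) ≡ endAt s (to f (face M (e , true)) , to f (face M (e , false))))
                    × (endAt (not sG) (ends G j) ≡ endAt (not s) (to f (face M (e , true)) , to f (face M (e , false))))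
  side = chooseSide (ends G j) _ _ sG ends-j
  s : Bool
  s = proj₁ side
  open AddVertex T M loopless e s
  G⁺ : MGraph
  G⁺ = subdivideDouble G j sG
  f⁺ : Fin (suc (F M)) → Fin (suc (V G))
  f⁺ = to (extendLast f)
  a : Fin (suc (V G))
  a = inject₁ (endAt sG (ends G j))
  a-face : endAt sG (ends G j) ≡ to f (face M (e , s))
  a-face = trans (proj₁ (proj₂ side)) (endAt-pair (λ b → to f (face M (e , b))) s)

  Preserved : Fin (E T + 2) → Set
  Preserved i = ends G⁺ (to (extendEdges g) i) ≈ᵤ mapPair f⁺ (faceW (toW (i , true)) , faceW (toW (i , false)))

  -- Edges of T other than e keep both faces.
  other-edge : ∀ i → i ≢ e → Preserved (i ↑ˡ 2)
  other-edge i i≢e = ≈ᵤ-subst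
    (sym (trans (cong (ends G⁺) (extendEdges-old g i)) (subdivideDouble-other G j sG (to g i) (λ gi≡j → i≢e (trans (sym (from-to g i)) (cong (from g) gi≡j))))))
    (sym (trans (cong (mapPair f⁺) (cong₂ _,_ (trans (cong faceW (toW-old i true)) (faceW-o (i , true) (λ eq → i≢e (cong proj₁ eq))))
                                               (trans (cong faceW (toW-old i false)) (faceW-o (i , false) (λ eq → i≢e (cong proj₁ eq))))))
         (cong₂ _,_ (extendLast-inject₁ f _) (extendLast-inject₁ f _))))
    (≈ᵤ-map inject₁ (preserves i))

  -- Edge e now borders the new triangle on the side of dx.
  split-edge : Preserved (e ↑ˡ 2)
  split-edge = ≈ᵤ-subst
    (sym (trans (cong (ends G⁺) (trans (extendEdges-old g e) (cong (_↑ˡ 2) (to-from g j)))) (subdivideDouble-split G j sG)))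
    (sym (trans (cong (mapPair f⁺) (trans (cong₂ _,_ (cong faceW (toW-old e true)) (cong faceW (toW-old e false)))
              (pair-setEnd s (λ b → faceW (inj₁ (e , b))) (λ b → inject₁ (face M (e , b))) newF faceW-dx
                 (faceW-o (e , not s) (λ eq → not-≢ s (cong proj₂ eq))))))
           (trans (mapPair-setEnd f⁺ s newF _) (cong₂ (setEnd s) (extendLast-last f) (cong₂ _,_ (extendLast-inject₁ f _) (extendLast-inject₁ f _))))))
    (setEnd-≈ᵤ (mapPair inject₁ (ends G j)) sG s (inject₁ (to f (face M (e , true)))) (inject₁ (to f (face M (e , false)))) (fromℕ (V G))
       (trans (endAt-mapPair inject₁ (not sG) (ends G j)) (trans (cong inject₁ (proj₂ (proj₂ side))) (sym (endAt-mapPair inject₁ (not s) _)))))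
    where
    not-≢ : ∀ b → not b ≢ b
    not-≢ true ()
    not-≢ false ()

  role-face : ∀ r → f⁺ (faceW (inj₂ r)) ≡ roleFace a (fromℕ (V G)) r
  role-face Xo = trans (extendLast-inject₁ f _) (cong inject₁ (sym a-face))
  role-face Yi = trans (extendLast-inject₁ f _) (cong inject₁ (sym a-face))
  role-face Yo = extendLast-last f
  role-face Xi = extendLast-last f

  -- The two new edges of T are dual to the digon a—n.
  new-edge : ∀ k → Preserved (E T ↑ʳ k)
  new-edge k = ≈ᵤ-subst
    (sym (trans (cong (ends G⁺) (extendEdges-new g k)) (subdivideDouble-new G j sG k)))
    (sym (trans (cong (mapPair f⁺) (cong₂ _,_ (cong faceW (toW-new k true)) (cong faceW (toW-new k false))))
          (cong₂ _,_ (role-face (roleOf s k true)) (role-face (roleOf s k false)))))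
    (digon-≈ᵤ s k a (fromℕ (V G)))

  preserves⁺ : ∀ i → Preserved i
  preserves⁺ i = subst Preserved (join-splitAt (E T) 2 i) (by-part (splitAt (E T) i))
    where
    by-part : ∀ v → Preserved (join (E T) 2 v)
    by-part (inj₁ i) with i Fin.≟ e
    ... | yes refl = split-edge
    ... | no i≢e   = other-edge i i≢e
    by-part (inj₂ k) = new-edge k

-- K3 (edges 0—1, 1—2, 0—2) embedded in the plane: at each
-- vertex σK3 swaps its two darts, the faces are the inside 0F and the
-- outside 1F.  Its dual θ, two vertices joined by three edges, is realizable.
σK3 : Dart K3 → Dart K3
σK3 (0F , true) = (2F , true)
σK3 (0F , false) = (1F , true)
σK3 (1F , true) = (0F , false)
σK3 (1F , false) = (2F , false)
σK3 (2F , true) = (0F , true)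
σK3 (2F , false) = (1F , false)

σK3-involutive : ∀ d → σK3 (σK3 d) ≡ d
σK3-involutive (0F , true) = refl
σK3-involutive (0F , false) = refl
σK3-involutive (1F , true) = refl
σK3-involutive (1F , false) = refl
σK3-involutive (2F , true) = refl
σK3-involutive (2F , false) = refl

σK3-tail : ∀ d → tail K3 (σK3 d) ≡ tail K3 d
σK3-tail (0F , true) = refl
σK3-tail (0F , false) = refl
σK3-tail (1F , true) = refl
σK3-tail (1F , false) = refl
σK3-tail (2F , true) = refl
σK3-tail (2F , false) = refl

faceK3 : Dart K3 → Fin 2
faceK3 (0F , true) = 0F
faceK3 (0F , false) = 1F
faceK3 (1F , true) = 0F
faceK3 (1F , false) = 1F
faceK3 (2F , true) = 1F
faceK3 (2F , false) = 0F

σK3-cyclic : ∀ d d' → tail K3 d ≡ tail K3 d' → Reach σK3 d d'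
σK3-cyclic (0F , true) (0F , true) refl = 0 , refl
σK3-cyclic (0F , true) (0F , false) ()
σK3-cyclic (0F , true) (1F , true) ()
σK3-cyclic (0F , true) (1F , false) ()
σK3-cyclic (0F , true) (2F , true) refl = 1 , refl
σK3-cyclic (0F , true) (2F , false) ()
σK3-cyclic (0F , false) (0F , true) ()
σK3-cyclic (0F , false) (0F , false) refl = 0 , refl
σK3-cyclic (0F , false) (1F , true) refl = 1 , refl
σK3-cyclic (0F , false) (1F , false) ()
σK3-cyclic (0F , false) (2F , true) ()
σK3-cyclic (0F , false) (2F , false) ()
σK3-cyclic (1F , true) (0F , true) ()
σK3-cyclic (1F , true) (0F , false) refl = 1 , refl
σK3-cyclic (1F , true) (1F , true) refl = 0 , refl
σK3-cyclic (1F , true) (1F , false) ()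
σK3-cyclic (1F , true) (2F , true) ()
σK3-cyclic (1F , true) (2F , false) ()
σK3-cyclic (1F , false) (0F , true) ()
σK3-cyclic (1F , false) (0F , false) ()
σK3-cyclic (1F , false) (1F , true) ()
σK3-cyclic (1F , false) (1F , false) refl = 0 , refl
σK3-cyclic (1F , false) (2F , true) ()
σK3-cyclic (1F , false) (2F , false) refl = 1 , refl
σK3-cyclic (2F , true) (0F , true) refl = 1 , refl
σK3-cyclic (2F , true) (0F , false) ()
σK3-cyclic (2F , true) (1F , true) ()
σK3-cyclic (2F , true) (1F , false) ()
σK3-cyclic (2F , true) (2F , true) refl = 0 , refl
σK3-cyclic (2F , true) (2F , false) ()
σK3-cyclic (2F , false) (0F , true) ()
σK3-cyclic (2F , false) (0F , false) ()
σK3-cyclic (2F , false) (1F , true) ()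
σK3-cyclic (2F , false) (1F , false) refl = 1 , refl
σK3-cyclic (2F , false) (2F , true) ()
σK3-cyclic (2F , false) (2F , false) refl = 0 , refl

φK3 : Dart K3 → Dart K3
φK3 x = σK3 (flipD {K3} x)

faceK3-orbit : ∀ d d' → faceK3 d ≡ faceK3 d' → Reach φK3 d d'
faceK3-orbit (0F , true) (0F , true) refl = 0 , refl
faceK3-orbit (0F , true) (0F , false) ()
faceK3-orbit (0F , true) (1F , true) refl = 1 , refl
faceK3-orbit (0F , true) (1F , false) ()
faceK3-orbit (0F , true) (2F , true) ()
faceK3-orbit (0F , true) (2F , false) refl = 2 , refl
faceK3-orbit (0F , false) (0F , true) ()
faceK3-orbit (0F , false) (0F , false) refl = 0 , refl
faceK3-orbit (0F , false) (1F , true) ()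
faceK3-orbit (0F , false) (1F , false) refl = 2 , refl
faceK3-orbit (0F , false) (2F , true) refl = 1 , refl
faceK3-orbit (0F , false) (2F , false) ()
faceK3-orbit (1F , true) (0F , true) refl = 2 , refl
faceK3-orbit (1F , true) (0F , false) ()
faceK3-orbit (1F , true) (1F , true) refl = 0 , refl
faceK3-orbit (1F , true) (1F , false) ()
faceK3-orbit (1F , true) (2F , true) ()
faceK3-orbit (1F , true) (2F , false) refl = 1 , refl
faceK3-orbit (1F , false) (0F , true) ()
faceK3-orbit (1F , false) (0F , false) refl = 1 , refl
faceK3-orbit (1F , false) (1F , true) ()
faceK3-orbit (1F , false) (1F , false) refl = 0 , refl
faceK3-orbit (1F , false) (2F , true) refl = 2 , refl
faceK3-orbit (1F , false) (2F , false) ()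
faceK3-orbit (2F , true) (0F , true) ()
faceK3-orbit (2F , true) (0F , false) refl = 2 , refl
faceK3-orbit (2F , true) (1F , true) ()
faceK3-orbit (2F , true) (1F , false) refl = 1 , refl
faceK3-orbit (2F , true) (2F , true) refl = 0 , refl
faceK3-orbit (2F , true) (2F , false) ()
faceK3-orbit (2F , false) (0F , true) refl = 1 , refl
faceK3-orbit (2F , false) (0F , false) ()
faceK3-orbit (2F , false) (1F , true) refl = 2 , refl
faceK3-orbit (2F , false) (1F , false) ()
faceK3-orbit (2F , false) (2F , true) ()
faceK3-orbit (2F , false) (2F , false) refl = 0 , refl

faceK3-φK3 : ∀ d → faceK3 (φK3 d) ≡ faceK3 d
faceK3-φK3 (0F , true) = refl
faceK3-φK3 (0F , false) = refl
faceK3-φK3 (1F , true) = refl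
faceK3-φK3 (1F , false) = refl
faceK3-φK3 (2F , true) = refl
faceK3-φK3 (2F , false) = refl

faceK3-φK3* : ∀ k d → faceK3 (iter φK3 k d) ≡ faceK3 d
faceK3-φK3* zero d = refl
faceK3-φK3* (suc k) d = trans (faceK3-φK3 (iter φK3 k d)) (faceK3-φK3* k d)

K3-embedding : Embedding K3
K3-embedding = record
  { σ = mk↔ₛ′ σK3 σK3 σK3-involutive σK3-involutive
  ; σ-tail = σK3-tail
  ; σ-cyclic = σK3-cyclic
  ; F = 2
  ; face = faceK3
  ; face-orbit = faceK3-orbit
  ; orbit-face = λ d d' r → trans (sym (faceK3-φK3* (proj₁ r) d)) (cong faceK3 (proj₂ r))
  ; face-onto = λ { 0F → (0F , true) , refl ; 1F → (0F , false) , refl }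
  }

K3-loopless : Loopless K3
K3-loopless 0F ()
K3-loopless 1F ()
K3-loopless 2F ()

θ : MGraph
θ = dual K3 K3-embedding

realizable-θ : Realizable θ
realizable-θ = K3 , triangle , K3-loopless , K3-embedding , refl , ↔-refl , ↔-refl , λ e → inj₁ refl

-- The hypotheses of the theorem for a fixed vertex c of degree V + 1; this
-- is the invariant of the induction on the number of vertices.
record Hypotheses (G : MGraph) (c : Fin (V G)) : Set where
  field
    loopless    : Loopless G
    connected-c : ConnectedWithout G c
    deg-c       : deg G c ≡ suc (V G)
    deg-3       : ∀ v → v ≢ c → deg G v ≡ 3

incidence≤1 : ∀ G → Loopless G → ∀ x e → incidence G x e ≤ 1
incidence≤1 G loopless x e with δ-cases x (proj₁ (ends G e)) | δ-cases x (proj₂ (ends G e))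
... | inj₁ (refl , _) | inj₁ (x≡b , _) = ⊥-elim (loopless e x≡b)
... | inj₁ (_ , d₁)   | inj₂ (_ , d₂)  rewrite d₁ | d₂ = ≤-refl
... | inj₂ (_ , d₁)   | inj₁ (_ , d₂)  rewrite d₁ | d₂ = ≤-refl
... | inj₂ (_ , d₁)   | inj₂ (_ , d₂)  rewrite d₁ | d₂ = z≤n

incidence-pos : ∀ G x e → 1 ≤ incidence G x e → proj₁ (ends G e) ≡ x ⊎ proj₂ (ends G e) ≡ x
incidence-pos G x e pos with δ-cases x (proj₁ (ends G e)) | δ-cases x (proj₂ (ends G e))
... | inj₁ (x≡a , _) | _              = inj₁ (sym x≡a)
... | inj₂ _         | inj₁ (x≡b , _) = inj₂ (sym x≡b)
... | inj₂ (_ , d₁)  | inj₂ (_ , d₂)  rewrite d₁ | d₂ with pos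
...   | ()

incidence-zero : ∀ G x e → proj₁ (ends G e) ≢ x → proj₂ (ends G e) ≢ x → incidence G x e ≡ 0
incidence-zero G x e a≢x b≢x = cong₂ _+_ (δ-≢ (λ x≡a → a≢x (sym x≡a))) (δ-≢ (λ x≡b → b≢x (sym x≡b)))

incidence-one : ∀ G x e → Loopless G → (proj₁ (ends G e) ≡ x ⊎ proj₂ (ends G e) ≡ x) → incidence G x e ≡ 1
incidence-one G x e loopless (inj₁ refl) = cong₂ _+_ (δ-refl _) (δ-≢ (loopless e))
incidence-one G x e loopless (inj₂ refl) = cong₂ _+_ (δ-≢ (λ a≡b → loopless e (sym a≡b))) (δ-refl _)

incidence-zero⁻¹ : ∀ G → Loopless G → ∀ x e → incidence G x e ≡ 0 → proj₁ (ends G e) ≢ x × proj₂ (ends G e) ≢ x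
incidence-zero⁻¹ G loopless x e zero-inc =
    (λ a≡x → 1+n≰n (≤-reflexive (trans (sym (incidence-one G x e loopless (inj₁ a≡x))) zero-inc)))
  , (λ b≡x → 1+n≰n (≤-reflexive (trans (sym (incidence-one G x e loopless (inj₂ b≡x))) zero-inc)))

-- joins G c v e: how often edge e joins c to v (at most once if c ≢ v).
-- Summed over v it counts the incidences of e at c.
joins : (G : MGraph) → Fin (V G) → Fin (V G) → Fin (E G) → ℕ
joins G c v e = δ c (proj₁ (ends G e)) * δ v (proj₂ (ends G e)) + δ v (proj₁ (ends G e)) * δ c (proj₂ (ends G e))

pair-η : ∀ {A : Set} (p : A × A) → p ≡ (proj₁ p , proj₂ p)
pair-η (a , b) = refl

δ-pos : ∀ {n} {a b : Fin n} → 1 ≤ δ a b → a ≡ b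
δ-pos {a = a} {b} pos with δ-cases a b
... | inj₁ (a≡b , _) = a≡b
... | inj₂ (_ , d)   = ⊥-elim (1+n≰n (≤-trans pos (≤-reflexive d)))

+-pos : ∀ m {n} → 1 ≤ m + n → 1 ≤ m ⊎ 1 ≤ n
+-pos zero    pos = inj₂ pos
+-pos (suc m) _   = inj₁ (s≤s z≤n)

*-pos : ∀ m n → 1 ≤ m * n → 1 ≤ m × 1 ≤ n
*-pos (suc m) zero    pos = ⊥-elim (1+n≰n (≤-trans pos (≤-reflexive (*-zeroʳ (suc m)))))
*-pos (suc m) (suc n) _   = s≤s z≤n , s≤s z≤n

*-zero-either : ∀ x y → x ≡ 0 ⊎ y ≡ 0 → x * y ≡ 0
*-zero-either x y (inj₁ refl) = refl
*-zero-either x y (inj₂ refl) = *-zeroʳ x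

*-≤-right : ∀ {x} y → x ≤ 1 → x * y ≤ y
*-≤-right y x≤1 = ≤-trans (*-monoˡ-≤ y x≤1) (≤-reflexive (+-identityʳ y))

joins-pos : ∀ G c v e → 1 ≤ joins G c v e → ends G e ≈ᵤ (c , v)
joins-pos G c v e pos with +-pos (δ c a * δ v b) pos
  where
  a b : Fin (V G)
  a = proj₁ (ends G e)
  b = proj₂ (ends G e)
... | inj₁ first  = let (c≡a , v≡b) = *-pos _ _ first  in inj₁ (trans (pair-η _) (cong₂ _,_ (sym (δ-pos c≡a)) (sym (δ-pos v≡b))))
... | inj₂ second = let (v≡a , c≡b) = *-pos _ _ second in inj₂ (trans (pair-η _) (cong₂ _,_ (sym (δ-pos v≡a)) (sym (δ-pos c≡b))))

joins≤1 : ∀ G c v → c ≢ v → ∀ e → joins G c v e ≤ 1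
joins≤1 G c v c≢v e with δ-cases c a
  where
  a : Fin (V G)
  a = proj₁ (ends G e)
... | inj₁ (refl , _) = begin
  δ c c * δ v b + δ v c * δ c b ≡⟨ cong (δ c c * δ v b +_) (*-zero-either (δ v c) (δ c b) (inj₁ (δ-≢ (λ v≡c → c≢v (sym v≡c))))) ⟩
  δ c c * δ v b + 0              ≡⟨ +-identityʳ _ ⟩
  δ c c * δ v b                  ≤⟨ *-≤-right (δ v b) (δ≤1 c c) ⟩
  δ v b                          ≤⟨ δ≤1 v b ⟩
  1                              ∎
  where
  open ≤-Reasoning
  b : Fin (V G)
  b = proj₂ (ends G e)
... | inj₂ (_ , d) = begin
  δ c a * δ v b + δ v a * δ c b ≡⟨ cong (_+ δ v a * δ c b) (*-zero-either (δ c a) (δ v b) (inj₁ d)) ⟩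
  δ v a * δ c b                  ≤⟨ *-≤-right (δ c b) (δ≤1 v a) ⟩
  δ c b                          ≤⟨ δ≤1 c b ⟩
  1                              ∎
  where
  open ≤-Reasoning
  a b : Fin (V G)
  a = proj₁ (ends G e)
  b = proj₂ (ends G e)

joins-self : ∀ G c → Loopless G → ∀ e → joins G c c e ≡ 0
joins-self G c loopless e = both-zero (one-is-zero (δ-cases c a))
  where
  a b : Fin (V G)
  a = proj₁ (ends G e)
  b = proj₂ (ends G e)
  both-zero : δ c a ≡ 0 ⊎ δ c b ≡ 0 → joins G c c e ≡ 0
  both-zero z = cong₂ _+_ (*-zero-either (δ c a) (δ c b) z) (*-zero-either (δ c a) (δ c b) z)
  one-is-zero : (c ≡ a × δ c a ≡ 1) ⊎ (c ≢ a × δ c a ≡ 0) → δ c a ≡ 0 ⊎ δ c b ≡ 0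
  one-is-zero (inj₁ (c≡a , _)) = inj₂ (δ-≢ (λ c≡b → loopless e (trans (sym c≡a) c≡b)))
  one-is-zero (inj₂ (_ , d))   = inj₁ d

∑-joins : ∀ G c e → ∑[ v < V G ] joins G c v e ≡ incidence G c e
∑-joins G c e = begin
  ∑[ v < V G ] (δ c a * δ v b + δ v a * δ c b)                  ≡⟨ ∑-distrib-+ (λ v → δ c a * δ v b) (λ v → δ v a * δ c b) ⟩
  ∑[ v < V G ] (δ c a * δ v b) + ∑[ v < V G ] (δ v a * δ c b)   ≡⟨ cong₂ _+_ (sym (*-distribˡ-sum (δ c a) (λ v → δ v b)))
                                                                     (trans (sum-cong-≗ (λ v → *-comm (δ v a) (δ c b))) (sym (*-distribˡ-sum (δ c b) (λ v → δ v a)))) ⟩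
  δ c a * ∑[ v < V G ] δ v b + δ c b * ∑[ v < V G ] δ v a       ≡⟨ cong₂ _+_ (cong (δ c a *_) (∑-δ′ (V G) b)) (cong (δ c b *_) (∑-δ′ (V G) a)) ⟩
  δ c a * 1 + δ c b * 1                                          ≡⟨ cong₂ _+_ (*-identityʳ (δ c a)) (*-identityʳ (δ c b)) ⟩
  δ c a + δ c b                                                  ∎
  where
  open ≡-Reasoning
  a b : Fin (V G)
  a = proj₁ (ends G e)
  b = proj₂ (ends G e)

-- A leaf at c is a vertex v ≠ c joined to c by two
-- parallel edges e1, e2, whose third edge e3 goes to some w ≠ c, and with
-- no further edges.  It is exactly what subdivideDouble creates, so a
-- graph with a leaf can be reduced by one vertex.
record Leaf (G : MGraph) (c : Fin (V G)) : Set where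
  field
    v w        : Fin (V G)
    e1 e2 e3   : Fin (E G)
    v≢c        : v ≢ c
    w≢c        : w ≢ c
    w≢v        : w ≢ v
    e1≢e2      : e1 ≢ e2
    e3≢e1      : e3 ≢ e1
    e3≢e2      : e3 ≢ e2
    ends-e1    : ends G e1 ≈ᵤ (c , v)
    ends-e2    : ends G e2 ≈ᵤ (c , v)
    ends-e3    : ends G e3 ≈ᵤ (v , w)
    only-three : ∀ e → e ≢ e1 → e ≢ e2 → e ≢ e3 → proj₁ (ends G e) ≢ v × proj₂ (ends G e) ≢ v

≈ᵤ-has-fst : ∀ {n} {p : Fin n × Fin n} {a b : Fin n} → p ≈ᵤ (a , b) → proj₁ p ≡ a ⊎ proj₂ p ≡ a
≈ᵤ-has-fst (inj₁ refl) = inj₁ refl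
≈ᵤ-has-fst (inj₂ refl) = inj₂ refl

≈ᵤ-has-snd : ∀ {n} {p : Fin n × Fin n} {a b : Fin n} → p ≈ᵤ (a , b) → proj₁ p ≡ b ⊎ proj₂ p ≡ b
≈ᵤ-has-snd (inj₁ refl) = inj₂ refl
≈ᵤ-has-snd (inj₂ refl) = inj₁ refl

other-end : ∀ G v e → (proj₁ (ends G e) ≡ v ⊎ proj₂ (ends G e) ≡ v) → Σ (Fin (V G)) λ w → ends G e ≈ᵤ (v , w)
other-end G v e (inj₁ a≡v) = proj₂ (ends G e) , inj₁ (trans (pair-η _) (cong (_, proj₂ (ends G e)) a≡v))
other-end G v e (inj₂ b≡v) = proj₁ (ends G e) , inj₂ (trans (pair-η _) (cong (proj₁ (ends G e) ,_) b≡v))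

≈ᵤ-other-end : ∀ {n} {p : Fin n × Fin n} {c v z : Fin n} → p ≈ᵤ (c , v) → (p ≡ (v , z) ⊎ p ≡ (z , v)) → z ≡ c ⊎ z ≡ v
≈ᵤ-other-end (inj₁ refl) (inj₁ eq) = inj₂ (sym (cong proj₂ eq))
≈ᵤ-other-end (inj₁ refl) (inj₂ eq) = inj₁ (sym (cong proj₁ eq))
≈ᵤ-other-end (inj₂ refl) (inj₁ eq) = inj₁ (sym (cong proj₂ eq))
≈ᵤ-other-end (inj₂ refl) (inj₂ eq) = inj₂ (sym (cong proj₁ eq))

no-loop : ∀ G → Loopless G → ∀ e {a} → ends G e ≈ᵤ (a , a) → ⊥
no-loop G loopless e (inj₁ ends≡) = loopless e (trans (cong proj₁ ends≡) (sym (cong proj₂ ends≡)))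
no-loop G loopless e (inj₂ ends≡) = loopless e (trans (cong proj₁ ends≡) (sym (cong proj₂ ends≡)))

+-cong₄ : ∀ {a b c d p q r t : ℕ} → a ≡ p → b ≡ q → c ≡ r → d ≡ t → a + b + c + d ≡ p + q + r + t
+-cong₄ refl refl refl refl = refl

four-incident : ∀ G x (e1 e2 e3 e4 : Fin (E G))
  → e1 ≢ e2 → e1 ≢ e3 → e1 ≢ e4 → e2 ≢ e3 → e2 ≢ e4 → e3 ≢ e4
  → 1 ≤ incidence G x e1 → 1 ≤ incidence G x e2 → 1 ≤ incidence G x e3 → 1 ≤ incidence G x e4
  → ∀ e → δ e1 e + δ e2 e + δ e3 e + δ e4 e ≤ incidence G x e
four-incident G x e1 e2 e3 e4 n12 n13 n14 n23 n24 n34 i1 i2 i3 i4 e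
  with e Fin.≟ e1 | e Fin.≟ e2 | e Fin.≟ e3 | e Fin.≟ e4
... | yes refl | _ | _ | _ = ≤-trans (≤-reflexive (+-cong₄ (δ-refl e) (δ-≢ (≢-sym n12)) (δ-≢ (≢-sym n13)) (δ-≢ (≢-sym n14)))) i1
... | no m1 | yes refl | _ | _ = ≤-trans (≤-reflexive (+-cong₄ (δ-≢ (≢-sym m1)) (δ-refl e) (δ-≢ (≢-sym n23)) (δ-≢ (≢-sym n24)))) i2
... | no m1 | no m2 | yes refl | _ = ≤-trans (≤-reflexive (+-cong₄ (δ-≢ (≢-sym m1)) (δ-≢ (≢-sym m2)) (δ-refl e) (δ-≢ (≢-sym n34)))) i3
... | no m1 | no m2 | no m3 | yes refl = ≤-trans (≤-reflexive (+-cong₄ (δ-≢ (≢-sym m1)) (δ-≢ (≢-sym m2)) (δ-≢ (≢-sym m3)) (δ-refl e))) i4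
... | no m1 | no m2 | no m3 | no m4 = ≤-trans (≤-reflexive (+-cong₄ (δ-≢ (≢-sym m1)) (δ-≢ (≢-sym m2)) (δ-≢ (≢-sym m3)) (δ-≢ (≢-sym m4)))) (z≤n {incidence G x e})

only-three-incident : ∀ G → Loopless G → ∀ v (e1 e2 e3 : Fin (E G)) → e1 ≢ e2 → e3 ≢ e1 → e3 ≢ e2
  → incidence G v e1 ≡ 1 → incidence G v e2 ≡ 1 → 1 ≤ incidence G v e3 → ∑[ e < E G ] incidence G v e ≡ 3
  → ∀ e → e ≢ e1 → e ≢ e2 → e ≢ e3 → proj₁ (ends G e) ≢ v × proj₂ (ends G e) ≢ v
only-three-incident G loopless v e1 e2 e3 e1≢e2 e3≢e1 e3≢e2 inc1 inc2 inc3 deg≡3 e e≢e1 e≢e2 e≢e3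
  with incidence G v e in inc
... | zero  = incidence-zero⁻¹ G loopless v e inc
... | suc _ = ⊥-elim (1+n≰n (begin
  4                                                      ≡⟨ sym ∑-indicators ⟩
  ∑[ i < E G ] (δ e1 i + δ e2 i + δ e3 i + δ e i)        ≤⟨ ∑-mono-≤ (E G) pointwise ⟩
  ∑[ i < E G ] incidence G v i                           ≡⟨ deg≡3 ⟩
  3                                                      ∎))
  where
  open ≤-Reasoning
  pointwise : ∀ i → δ e1 i + δ e2 i + δ e3 i + δ e i ≤ incidence G v i
  pointwise = four-incident G v e1 e2 e3 e e1≢e2 (≢-sym e3≢e1) (≢-sym e≢e1) (≢-sym e3≢e2) (≢-sym e≢e2) (≢-sym e≢e3)
                (≤-reflexive (sym inc1)) (≤-reflexive (sym inc2)) inc3 (subst (1 ≤_) (sym inc) (s≤s z≤n))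
  ∑-indicators : ∑[ i < E G ] (δ e1 i + δ e2 i + δ e3 i + δ e i) ≡ 4
  ∑-indicators = begin-equality
    ∑[ i < E G ] (δ e1 i + δ e2 i + δ e3 i + δ e i)
      ≡⟨ ∑-distrib-+ (λ i → δ e1 i + δ e2 i + δ e3 i) (δ e) ⟩
    ∑[ i < E G ] (δ e1 i + δ e2 i + δ e3 i) + ∑[ i < E G ] δ e i
      ≡⟨ cong (_+ _) (∑-distrib-+ (λ i → δ e1 i + δ e2 i) (δ e3)) ⟩
    ∑[ i < E G ] (δ e1 i + δ e2 i) + ∑[ i < E G ] δ e3 i + ∑[ i < E G ] δ e i
      ≡⟨ cong (λ t → t + _ + _) (∑-distrib-+ (δ e1) (δ e2)) ⟩
    ∑[ i < E G ] δ e1 i + ∑[ i < E G ] δ e2 i + ∑[ i < E G ] δ e3 i + ∑[ i < E G ] δ e i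
      ≡⟨ +-cong₄ (∑-δ (E G) e1) (∑-δ (E G) e2) (∑-δ (E G) e3) (∑-δ (E G) e) ⟩
    4 ∎

-- If G - c is connected and v has a path in G - c to some other vertex,
-- the neighbour w of v along e3 is not c: the edges e1, e2 lead to c and
-- there are no further edges at v.
third-neighbour-≢c : ∀ G → Loopless G → ∀ c v w (e1 e2 e3 : Fin (E G))
  → ends G e1 ≈ᵤ (c , v) → ends G e2 ≈ᵤ (c , v) → ends G e3 ≈ᵤ (v , w)
  → (∀ e → e ≢ e1 → e ≢ e2 → e ≢ e3 → proj₁ (ends G e) ≢ v × proj₂ (ends G e) ≢ v)
  → ∀ {t} → Star (AdjAvoid G c) v t → v ≢ t → w ≢ c
third-neighbour-≢c G loopless c v w e1 e2 e3 ends-e1 ends-e2 ends-e3 only-three (((e , e-joins) , _ , z≢c) ◅ _) _ w≡c =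
  by-edge (e Fin.≟ e1) (e Fin.≟ e2) (e Fin.≟ e3)
  where
  not-to-c : ends G e ≈ᵤ (c , v) → ⊥
  not-to-c ends≈ with ≈ᵤ-other-end ends≈ e-joins
  ... | inj₁ z≡c  = z≢c z≡c
  ... | inj₂ refl = no-loop G loopless e {v} e-joins
  by-edge : Dec (e ≡ e1) → Dec (e ≡ e2) → Dec (e ≡ e3) → ⊥
  by-edge (yes refl) _ _ = not-to-c ends-e1
  by-edge (no _) (yes refl) _ = not-to-c ends-e2
  by-edge (no _) (no _) (yes refl) = not-to-c (≈ᵤ-trans ends-e3 (subst (λ k → (v , w) ≈ᵤ (k , v)) w≡c (inj₂ refl)))
  by-edge (no n1) (no n2) (no n3) =
    [ (λ eq → proj₁ (only-three e n1 n2 n3) (cong proj₁ eq)) , (λ eq → proj₂ (only-three e n1 n2 n3) (cong proj₂ eq)) ] e-joins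
third-neighbour-≢c G loopless c v w e1 e2 e3 ends-e1 ends-e2 ends-e3 only-three ε v≢t = ⊥-elim (v≢t refl)

third-vertex : ∀ {n} (x y : Fin (3 + n)) → ∃[ t ] t ≢ x × t ≢ y
third-vertex x y with 0F Fin.≟ x | 0F Fin.≟ y
... | no 0≢x | no 0≢y = 0F , 0≢x , 0≢y
... | yes refl | _ with 1F Fin.≟ y
...   | no 1≢y   = 1F , (λ ()) , 1≢y
...   | yes refl = 2F , (λ ()) , (λ ())
third-vertex x y | no 0≢x | yes refl with 1F Fin.≟ x
...   | no 1≢x   = 1F , 1≢x , (λ ())
...   | yes refl = 2F , (λ ()) , (λ ())

module FindLeaf (G : MGraph) (c : Fin (V G)) (n : ℕ) (V≡ : V G ≡ 3 + n) (hyp : Hypotheses G c) where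
  open Hypotheses hyp

  multiplicity : Fin (V G) → ℕ
  multiplicity v = ∑[ e < E G ] joins G c v e

  ∑-multiplicity : ∑[ v < V G ] multiplicity v ≡ suc (V G)
  ∑-multiplicity = begin
    ∑[ v < V G ] ∑[ e < E G ] joins G c v e  ≡⟨ ∑-comm (λ v e → joins G c v e) ⟩
    ∑[ e < E G ] ∑[ v < V G ] joins G c v e  ≡⟨ sum-cong-≗ (∑-joins G c) ⟩
    ∑[ e < E G ] incidence G c e             ≡⟨ sym (deg-∑ G c) ⟩
    deg G c                                  ≡⟨ deg-c ⟩
    suc (V G)                                ∎
    where open ≡-Reasoning

  doubly-joined : ∃[ v ] 1 < multiplicity v
  doubly-joined = ∑-<-witness (V G) multiplicity (λ _ → 1) (subst₂ _<_ (sym (∑-const-1 (V G))) (sym ∑-multiplicity) ≤-refl)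

  v : Fin (V G)
  v = proj₁ doubly-joined

  v≢c : v ≢ c
  v≢c v≡c = 1+n≰n (≤-trans (<⇒≤ (proj₂ doubly-joined))
              (≤-reflexive (trans (cong multiplicity v≡c) (trans (sum-cong-≗ (joins-self G c loopless)) (sum-replicate-zero (E G))))))

  first-edge : ∃[ e ] 0 < joins G c v e
  first-edge = ∑-<-witness (E G) (joins G c v) (λ _ → 0) (subst (_< multiplicity v) (sym (sum-replicate-zero (E G))) (<-trans (s≤s z≤n) (proj₂ doubly-joined)))
  e1 : Fin (E G)
  e1 = proj₁ first-edge
  second-edge : ∃[ e ] δ e1 e < joins G c v e
  second-edge = ∑-<-witness (E G) (joins G c v) (δ e1) (subst (_< multiplicity v) (sym (∑-δ (E G) e1)) (proj₂ doubly-joined))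
  e2 : Fin (E G)
  e2 = proj₁ second-edge

  e1≢e2 : e1 ≢ e2
  e1≢e2 e1≡e2 = 1+n≰n (≤-trans (subst (λ t → suc t ≤ joins G c v e2) (trans (cong (λ t → δ t e2) e1≡e2) (δ-refl e2)) (proj₂ second-edge))
                                (joins≤1 G c v (≢-sym v≢c) e2))

  ends-e1 : ends G e1 ≈ᵤ (c , v)
  ends-e1 = joins-pos G c v e1 (proj₂ first-edge)
  ends-e2 : ends G e2 ≈ᵤ (c , v)
  ends-e2 = joins-pos G c v e2 (≤-trans (s≤s z≤n) (proj₂ second-edge))

  deg-v : ∑[ e < E G ] incidence G v e ≡ 3
  deg-v = trans (sym (deg-∑ G v)) (deg-3 v v≢c)

  ∑-e1-e2 : ∑[ e < E G ] (δ e1 e + δ e2 e) ≡ 2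
  ∑-e1-e2 = trans (∑-distrib-+ (δ e1) (δ e2)) (cong₂ _+_ (∑-δ (E G) e1) (∑-δ (E G) e2))

  third-edge : ∃[ e ] δ e1 e + δ e2 e < incidence G v e
  third-edge = ∑-<-witness (E G) (incidence G v) (λ e → δ e1 e + δ e2 e) (subst₂ _<_ (sym ∑-e1-e2) (sym deg-v) ≤-refl)
  e3 : Fin (E G)
  e3 = proj₁ third-edge
  e3-incident : 1 ≤ incidence G v e3
  e3-incident = ≤-trans (s≤s z≤n) (proj₂ third-edge)

  e3≢e1 : e3 ≢ e1
  e3≢e1 e3≡e1 = 1+n≰n (≤-trans (s≤s (≤-trans (≤-reflexive (sym (δ-refl e1))) (≤-trans (m≤m+n (δ e1 e1) (δ e2 e1)) (≤-reflexive (cong (λ t → δ e1 t + δ e2 t) (sym e3≡e1))))))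
                        (≤-trans (proj₂ third-edge) (incidence≤1 G loopless v e3)))

  e3≢e2 : e3 ≢ e2
  e3≢e2 e3≡e2 = 1+n≰n (≤-trans (s≤s (≤-trans (≤-reflexive (sym (δ-refl e2))) (≤-trans (m≤n+m (δ e2 e2) (δ e1 e2)) (≤-reflexive (cong (λ t → δ e1 t + δ e2 t) (sym e3≡e2))))))
                        (≤-trans (proj₂ third-edge) (incidence≤1 G loopless v e3)))

  neighbour : Σ (Fin (V G)) λ w → ends G e3 ≈ᵤ (v , w)
  neighbour = other-end G v e3 (incidence-pos G v e3 e3-incident)
  w : Fin (V G)
  w = proj₁ neighbour
  ends-e3 : ends G e3 ≈ᵤ (v , w)
  ends-e3 = proj₂ neighbour

  w≢v : w ≢ v
  w≢v w≡v = no-loop G loopless e3 (subst (λ k → ends G e3 ≈ᵤ (v , k)) w≡v ends-e3)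

  only-three : ∀ e → e ≢ e1 → e ≢ e2 → e ≢ e3 → proj₁ (ends G e) ≢ v × proj₂ (ends G e) ≢ v
  only-three = only-three-incident G loopless v e1 e2 e3 e1≢e2 e3≢e1 e3≢e2
                 (incidence-one G v e1 loopless (≈ᵤ-has-snd ends-e1)) (incidence-one G v e2 loopless (≈ᵤ-has-snd ends-e2))
                 e3-incident deg-v

  -- a vertex t ∉ {v , c}, reached from v inside G - c
  π : Fin (V G) ↔ Fin (3 + n)
  π = cast-id V≡
  t′ : ∃[ t ] t ≢ to π v × t ≢ to π c
  t′ = third-vertex (to π v) (to π c)
  t : Fin (V G)
  t = from π (proj₁ t′)

  w≢c : w ≢ c
  w≢c = third-neighbour-≢c G loopless c v w e1 e2 e3 ends-e1 ends-e2 ends-e3 only-three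
          (connected-c v t v≢c (λ t≡c → proj₂ (proj₂ t′) (trans (sym (to-from π _)) (cong (to π) t≡c))))
          (λ v≡t → proj₁ (proj₂ t′) (trans (sym (to-from π _)) (cong (to π) (sym v≡t))))

  leaf : Leaf G c
  leaf = record
    { v = v ; w = w ; e1 = e1 ; e2 = e2 ; e3 = e3
    ; v≢c = v≢c ; w≢c = w≢c ; w≢v = w≢v ; e1≢e2 = e1≢e2 ; e3≢e1 = e3≢e1 ; e3≢e2 = e3≢e2
    ; ends-e1 = ends-e1 ; ends-e2 = ends-e2 ; ends-e3 = ends-e3 ; only-three = only-three }

-- squash d : Fin (suc r) → Fin r is the identity on inject₁ and sends the
-- last element to d; it deletes the last vertex by identifying it with d.
squash : ∀ {r} → Fin r → Fin (suc r) → Fin r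
squash d x = [ (λ t → t) , (λ _ → d) ] (viewLast x)

squash-inject₁ : ∀ {r} (d : Fin r) t → squash d (inject₁ t) ≡ t
squash-inject₁ d t = cong [ (λ t → t) , (λ _ → d) ] (viewLast-inject₁ t)

squash-last : ∀ {r} (d : Fin r) → squash d (fromℕ r) ≡ d
squash-last {r} d = cong [ (λ t → t) , (λ _ → d) ] (viewLast-last r)

inject₁-squash : ∀ {r} (d : Fin r) x → x ≢ fromℕ r → inject₁ (squash d x) ≡ x
inject₁-squash d x x≢last with inject₁-or-last x
... | inj₁ (t , refl) = cong inject₁ (squash-inject₁ d t)
... | inj₂ x≡last     = ⊥-elim (x≢last x≡last)

squash-irrelevant : ∀ {r} (d₁ d₂ : Fin r) x → x ≢ fromℕ r → squash d₁ x ≡ squash d₂ x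
squash-irrelevant d₁ d₂ x x≢last = inject₁-injective (trans (inject₁-squash d₁ x x≢last) (sym (inject₁-squash d₂ x x≢last)))

2≤-of-distinct : ∀ {k} (a b : Fin k) → a ≢ b → 2 ≤ k
2≤-of-distinct {suc zero}    zero    zero    a≢b = ⊥-elim (a≢b refl)
2≤-of-distinct {suc (suc k)} _       _       _   = s≤s (s≤s z≤n)

↑ˡ≢↑ʳ : ∀ {m} (i : Fin m) (k : Fin 2) → i ↑ˡ 2 ≢ m ↑ʳ k
↑ˡ≢↑ʳ {m} i k eq with trans (sym (splitAt-↑ˡ m i 2)) (trans (cong (splitAt m) eq) (splitAt-↑ʳ m 2 k))
... | ()

↑ˡ-or-↑ʳ : ∀ m (x : Fin (m + 2)) → (∃[ i ] x ≡ i ↑ˡ 2) ⊎ (∃[ k ] x ≡ m ↑ʳ k)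
↑ˡ-or-↑ʳ m x with splitAt m x | join-splitAt m 2 x
... | inj₁ i | eq = inj₁ (i , sym eq)
... | inj₂ k | eq = inj₂ (k , sym eq)

sideOf : ∀ {A : Set} {p q : A × A} → p ≈ᵤ q → Bool
sideOf (inj₁ _) = true
sideOf (inj₂ _) = false

≈ᵤ-distinct : ∀ {k} {p : Fin k × Fin k} {a b : Fin k} → p ≈ᵤ (a , b) → a ≢ b → proj₁ p ≢ proj₂ p
≈ᵤ-distinct (inj₁ refl) a≢b eq = a≢b eq
≈ᵤ-distinct (inj₂ refl) a≢b eq = a≢b (sym eq)

≈ᵤ-avoids : ∀ {k} {p : Fin k × Fin k} {a b x} → p ≈ᵤ (a , b) → x ≢ a → x ≢ b → proj₁ p ≢ x × proj₂ p ≢ x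
≈ᵤ-avoids (inj₁ refl) x≢a x≢b = ≢-sym x≢a , ≢-sym x≢b
≈ᵤ-avoids (inj₂ refl) x≢a x≢b = ≢-sym x≢b , ≢-sym x≢a

≈ᵤ-ends : ∀ {k} {p : Fin k × Fin k} {x y a b} → p ≈ᵤ (x , y) → (p ≡ (a , b) ⊎ p ≡ (b , a)) → (a ≡ x ⊎ a ≡ y) × (b ≡ x ⊎ b ≡ y)
≈ᵤ-ends (inj₁ refl) (inj₁ eq) = inj₁ (sym (cong proj₁ eq)) , inj₂ (sym (cong proj₂ eq))
≈ᵤ-ends (inj₁ refl) (inj₂ eq) = inj₂ (sym (cong proj₂ eq)) , inj₁ (sym (cong proj₁ eq))
≈ᵤ-ends (inj₂ refl) (inj₁ eq) = inj₂ (sym (cong proj₁ eq)) , inj₁ (sym (cong proj₂ eq))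
≈ᵤ-ends (inj₂ refl) (inj₂ eq) = inj₁ (sym (cong proj₂ eq)) , inj₂ (sym (cong proj₁ eq))

star-map : ∀ {A B : Set} {R : A → A → Set} {R′ : B → B → Set} (ρ : A → B)
  → (∀ {a b} → R a b → ρ a ≡ ρ b ⊎ R′ (ρ a) (ρ b)) → ∀ {x y} → Star R x y → Star R′ (ρ x) (ρ y)
star-map {R = R} {R′ = R′} ρ step = kleisliStar ρ one-step
  where
  one-step : ∀ {a b} → R a b → Star R′ (ρ a) (ρ b)
  one-step {a} r with step r
  ... | inj₁ same = subst (Star R′ (ρ a)) same ε
  ... | inj₂ r′   = return r′

-- Relabel the vertices so
-- that v is last and the edges so that e1, e2 are the last two.  Deleting
-- v, e1, e2 and rerouting e3 to c gives G′ on r = V G - 1 vertices; then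
-- G ≅ subdivideDouble G′ j sG, where j is e3 in G′ and sG its side at c.
-- G′ again satisfies the hypotheses, with c′ (the image of c) in the role of c.
module Reduce (G : MGraph) (c : Fin (V G)) (n : ℕ) (V≡ : V G ≡ 3 + n) (hyp : Hypotheses G c) (L : Leaf G c) where
  open Hypotheses hyp
  open Leaf L

  r : ℕ
  r = 2 + n

  last : Fin (suc r)
  last = fromℕ r

  opaque
    πV : Fin (V G) ↔ Fin (suc r)
    πV = ↔-trans (cast-id V≡) (transpose (cast V≡ v) last)

    pv-v : to πV v ≡ last
    pv-v = transpose-left (cast V≡ v) last

  pv : Fin (V G) → Fin (suc r)
  pv = to πV

  pv-injective : ∀ {a b} → pv a ≡ pv b → a ≡ b
  pv-injective = to-injective πV

  pv≢last : ∀ a → a ≢ v → pv a ≢ last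
  pv≢last a a≢v eq = a≢v (pv-injective (trans eq (sym pv-v)))

  E′ : ℕ
  E′ = E G ∸ 2

  E≡ : E G ≡ E′ + 2
  E≡ = sym (m∸n+n≡m (2≤-of-distinct e1 e2 e1≢e2))

  t1 t2 : Fin (E′ + 2)
  t1 = E′ ↑ʳ 0F
  t2 = E′ ↑ʳ 1F

  t1≢t2 : t1 ≢ t2
  t1≢t2 eq with trans (sym (splitAt-↑ʳ E′ 2 0F)) (trans (cong (splitAt E′) eq) (splitAt-↑ʳ E′ 2 1F))
  ... | ()

  -- after the first transposition e2 sits at a2′ ≠ t1
  π₁ : Fin (E G) ↔ Fin (E′ + 2)
  π₁ = ↔-trans (cast-id E≡) (transpose (cast E≡ e1) t1)

  a2′ : Fin (E′ + 2)
  a2′ = to π₁ e2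

  a2′≢t1 : a2′ ≢ t1
  a2′≢t1 eq = e1≢e2 (to-injective π₁ (trans (transpose-left (cast E≡ e1) t1) (sym eq)))

  opaque
    πE : Fin (E G) ↔ Fin (E′ + 2)
    πE = ↔-trans π₁ (transpose a2′ t2)

    pe-e1 : to πE e1 ≡ t1
    pe-e1 = trans (cong (to (transpose a2′ t2)) (transpose-left (cast E≡ e1) t1))
                  (transpose-other a2′ t2 t1 (≢-sym a2′≢t1) t1≢t2)

    pe-e2 : to πE e2 ≡ t2
    pe-e2 = transpose-left a2′ t2

  pe : Fin (E G) → Fin (E′ + 2)
  pe = to πE

  pe-injective : ∀ {a b} → pe a ≡ pe b → a ≡ b
  pe-injective = to-injective πE

  old : Fin E′ → Fin (E G)
  old i = from πE (i ↑ˡ 2)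

  old-index : ∀ e → e ≢ e1 → e ≢ e2 → ∃[ i ] pe e ≡ i ↑ˡ 2
  old-index e e≢e1 e≢e2 with ↑ˡ-or-↑ʳ E′ (pe e)
  ... | inj₁ found     = found
  ... | inj₂ (0F , eq) = ⊥-elim (e≢e1 (pe-injective (trans eq (sym pe-e1))))
  ... | inj₂ (1F , eq) = ⊥-elim (e≢e2 (pe-injective (trans eq (sym pe-e2))))

  old-pe : ∀ e i → pe e ≡ i ↑ˡ 2 → old i ≡ e
  old-pe e i eq = trans (cong (from πE) (sym eq)) (from-to πE e)

  old≢e1 : ∀ i → old i ≢ e1
  old≢e1 i eq = ↑ˡ≢↑ʳ i 0F (trans (sym (to-from πE (i ↑ˡ 2))) (trans (cong pe eq) pe-e1))

  old≢e2 : ∀ i → old i ≢ e2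
  old≢e2 i eq = ↑ˡ≢↑ʳ i 1F (trans (sym (to-from πE (i ↑ˡ 2))) (trans (cong pe eq) pe-e2))

  j : Fin E′
  j = proj₁ (old-index e3 e3≢e1 e3≢e2)

  pe-e3 : pe e3 ≡ j ↑ˡ 2
  pe-e3 = proj₂ (old-index e3 e3≢e1 e3≢e2)

  -- The vertex map sq ∘ pv of the contraction: v goes to c′, others stay.
  c′ : Fin r
  c′ = squash zero (pv c)

  inject₁-c′ : inject₁ c′ ≡ pv c
  inject₁-c′ = inject₁-squash zero (pv c) (pv≢last c (≢-sym v≢c))

  sq : Fin (suc r) → Fin r
  sq = squash c′

  sq-v : sq (pv v) ≡ c′
  sq-v = trans (cong sq pv-v) (squash-last c′)

  inject₁-sq : ∀ a → a ≢ v → inject₁ (sq (pv a)) ≡ pv a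
  inject₁-sq a a≢v = inject₁-squash c′ (pv a) (pv≢last a a≢v)

  w′ : Fin r
  w′ = sq (pv w)

  c′≢w′ : c′ ≢ w′
  c′≢w′ eq = w≢c (sym (pv-injective (trans (sym inject₁-c′) (trans (cong inject₁ eq) (inject₁-sq w w≢v)))))

  G′ : MGraph
  G′ = mgraph r E′ (λ i → mapPair sq (mapPair pv (ends G (old i))))

  sG : Bool
  sG = sideOf ends-e3

  G⁺ : MGraph
  G⁺ = subdivideDouble G′ j sG

  ends-j : ends G′ j ≡ mapPair sq (mapPair pv (ends G e3))
  ends-j = cong (λ e → mapPair sq (mapPair pv (ends G e))) (old-pe e3 j pe-e3)

  c′-at-side : endAt sG (ends G′ j) ≡ c′
  c′-at-side = trans (cong (endAt sG) ends-j) (at-side ends-e3)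
    where
    at-side : ∀ (ends≈ : ends G e3 ≈ᵤ (v , w)) → endAt (sideOf ends≈) (mapPair sq (mapPair pv (ends G e3))) ≡ c′
    at-side (inj₁ eq) = trans (cong (λ p → endAt true (mapPair sq (mapPair pv p))) eq) sq-v
    at-side (inj₂ eq) = trans (cong (λ p → endAt false (mapPair sq (mapPair pv p))) eq) sq-v

  Preserved : Fin (E G) → Set
  Preserved e = ends G⁺ (pe e) ≈ᵤ mapPair pv (ends G e)

  e1-preserved : Preserved e1
  e1-preserved = ≈ᵤ-sym (≈ᵤ-subst refl
    (trans (cong₂ _,_ (sym inject₁-c′) pv-v) (trans (cong₂ _,_ (cong inject₁ (sym c′-at-side)) refl)
      (sym (trans (cong (ends G⁺) pe-e1) (subdivideDouble-new G′ j sG 0F)))))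
    (≈ᵤ-map pv ends-e1))

  e2-preserved : Preserved e2
  e2-preserved = ≈ᵤ-sym (≈ᵤ-trans (≈ᵤ-map pv ends-e2)
    (inj₂ (trans (cong₂ _,_ (trans (sym inject₁-c′) (cong inject₁ (sym c′-at-side))) pv-v)
      (cong swapPair (sym (trans (cong (ends G⁺) pe-e2) (subdivideDouble-new G′ j sG 1F)))))))

  e3-preserved : Preserved e3
  e3-preserved = subst (λ x → ends G⁺ x ≈ᵤ mapPair pv (ends G e3)) (sym pe-e3)
    (≈ᵤ-subst (sym (subdivideDouble-split G′ j sG)) refl
      (subst (λ p → setEnd sG last (mapPair inject₁ p) ≈ᵤ mapPair pv (ends G e3)) (sym ends-j) (by-side ends-e3)))
    where
    by-side : ∀ (ends≈ : ends G e3 ≈ᵤ (v , w))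
      → setEnd (sideOf ends≈) last (mapPair inject₁ (mapPair sq (mapPair pv (ends G e3)))) ≈ᵤ mapPair pv (ends G e3)
    by-side (inj₁ eq) = subst (λ p → setEnd true last (mapPair inject₁ (mapPair sq (mapPair pv p))) ≈ᵤ mapPair pv p) (sym eq)
                          (inj₁ (cong₂ _,_ (sym pv-v) (inject₁-sq w w≢v)))
    by-side (inj₂ eq) = subst (λ p → setEnd false last (mapPair inject₁ (mapPair sq (mapPair pv p))) ≈ᵤ mapPair pv p) (sym eq)
                          (inj₁ (cong₂ _,_ (inject₁-sq w w≢v) (sym pv-v)))

  other-preserved : ∀ e → e ≢ e1 → e ≢ e2 → e ≢ e3 → Preserved e
  other-preserved e e≢e1 e≢e2 e≢e3 = inj₁ (begin
    ends G⁺ (pe e)                                        ≡⟨ cong (ends G⁺) pe-e ⟩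
    ends G⁺ (i ↑ˡ 2)                                      ≡⟨ subdivideDouble-other G′ j sG i i≢j ⟩
    mapPair inject₁ (mapPair sq (mapPair pv (ends G (old i)))) ≡⟨ cong (λ e′ → mapPair inject₁ (mapPair sq (mapPair pv (ends G e′)))) (old-pe e i pe-e) ⟩
    mapPair inject₁ (mapPair sq (mapPair pv (ends G e)))  ≡⟨ unsquashed (ends G e) (only-three e e≢e1 e≢e2 e≢e3) ⟩
    mapPair pv (ends G e)                                 ∎)
    where
    open ≡-Reasoning
    i : Fin E′
    i = proj₁ (old-index e e≢e1 e≢e2)
    pe-e : pe e ≡ i ↑ˡ 2
    pe-e = proj₂ (old-index e e≢e1 e≢e2)
    i≢j : i ≢ j
    i≢j i≡j = e≢e3 (pe-injective (trans pe-e (trans (cong (_↑ˡ 2) i≡j) (sym pe-e3))))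
    unsquashed : ∀ p → proj₁ p ≢ v × proj₂ p ≢ v → mapPair inject₁ (mapPair sq (mapPair pv p)) ≡ mapPair pv p
    unsquashed (a , b) (a≢v , b≢v) = cong₂ _,_ (inject₁-sq a a≢v) (inject₁-sq b b≢v)

  G≅G⁺ : Isomorphic G G⁺
  G≅G⁺ = πV , πE , preserved
    where
    preserved : ∀ e → Preserved e
    preserved e with e Fin.≟ e1 | e Fin.≟ e2 | e Fin.≟ e3
    ... | yes refl | _        | _        = e1-preserved
    ... | no _     | yes refl | _        = e2-preserved
    ... | no _     | no _     | yes refl = e3-preserved
    ... | no e≢e1  | no e≢e2  | no e≢e3  = other-preserved e e≢e1 e≢e2 e≢e3

  -- G′ is loopless: e3 becomes c′—w′ with w ≠ c, other edges avoid v.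
  loopless′ : Loopless G′
  loopless′ i with old i Fin.≟ e3
  ... | yes old≡e3 = ≈ᵤ-distinct (subst (λ e → mapPair sq (mapPair pv (ends G e)) ≈ᵤ (c′ , w′)) (sym old≡e3)
                                    (≈ᵤ-subst refl (cong₂ _,_ sq-v refl) (≈ᵤ-map sq (≈ᵤ-map pv ends-e3)))) c′≢w′
  ... | no old≢e3 = λ eq → loopless (old i) (pv-injective (trans (sym (inject₁-sq _ a≢v)) (trans (cong inject₁ eq) (inject₁-sq _ b≢v))))
    where
    a≢v : proj₁ (ends G (old i)) ≢ v
    a≢v = proj₁ (only-three (old i) (old≢e1 i) (old≢e2 i) old≢e3)
    b≢v : proj₂ (ends G (old i)) ≢ v
    b≢v = proj₂ (only-three (old i) (old≢e1 i) (old≢e2 i) old≢e3)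

  -- Degrees of G′ are degrees of G on the old edges, which miss e1, e2.
  ∑-old : ∀ (f : Fin (E G) → ℕ) {k} → ∑[ e < E G ] f e ≡ f e1 + f e2 + k → ∑[ i < E′ ] f (old i) ≡ k
  ∑-old f {k} ∑f≡ = +-cancelˡ-≡ (f e1 + f e2) _ _ (begin
    f e1 + f e2 + ∑[ i < E′ ] f (old i)                                   ≡⟨ +-comm (f e1 + f e2) _ ⟩
    ∑[ i < E′ ] f (old i) + (f e1 + f e2)                                 ≡⟨ cong (∑[ i < E′ ] f (old i) +_) (cong₂ _+_ (cong f (sym old-t1)) (trans (cong f (sym old-t2)) (sym (+-identityʳ _)))) ⟩
    ∑[ i < E′ ] f (from πE (i ↑ˡ 2)) + ∑[ k < 2 ] f (from πE (E′ ↑ʳ k)) ≡⟨ sym (∑-split E′ 2 (λ x → f (from πE x))) ⟩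
    ∑[ x < E′ + 2 ] f (from πE x)                                         ≡⟨ sym (∑-permute f (↔-sym πE)) ⟩
    ∑[ e < E G ] f e                                                      ≡⟨ ∑f≡ ⟩
    f e1 + f e2 + k                                                       ∎)
    where
    open ≡-Reasoning
    old-t1 : from πE t1 ≡ e1
    old-t1 = trans (cong (from πE) (sym pe-e1)) (from-to πE e1)
    old-t2 : from πE t2 ≡ e2
    old-t2 = trans (cong (from πE) (sym pe-e2)) (from-to πE e2)

  -- Each vertex t ≠ c′ of G′ is a vertex x ∉ {c , v} of G, with the same
  -- incidences on the old edges.
  deg-3′ : ∀ t → t ≢ c′ → deg G′ t ≡ 3
  deg-3′ t t≢c′ = begin
    deg G′ t                                ≡⟨ deg-∑ G′ t ⟩
    ∑[ i < E′ ] incidence G′ t i            ≡⟨ sum-cong-≗ (λ i → cong₂ _+_ (δ-sq (proj₁ (ends G (old i)))) (δ-sq (proj₂ (ends G (old i))))) ⟩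
    ∑[ i < E′ ] incidence G x (old i)       ≡⟨ ∑-old (incidence G x) deg-x ⟩
    3                                       ∎
    where
    open ≡-Reasoning
    x : Fin (V G)
    x = from πV (inject₁ t)
    pv-x : pv x ≡ inject₁ t
    pv-x = to-from πV (inject₁ t)
    x≢v : x ≢ v
    x≢v x≡v = fromℕ≢inject₁ (trans (sym pv-v) (trans (cong pv (sym x≡v)) pv-x))
    x≢c : x ≢ c
    x≢c x≡c = t≢c′ (inject₁-injective (trans (sym pv-x) (trans (cong pv x≡c) (sym inject₁-c′))))
    δ-sq : ∀ a → δ t (sq (pv a)) ≡ δ x a
    δ-sq a with a Fin.≟ v
    ... | yes refl = trans (cong (δ t) sq-v) (trans (δ-≢ t≢c′) (sym (δ-≢ x≢v)))
    ... | no a≢v   = trans (sym (δ-injective inject₁ inject₁-injective t (sq (pv a))))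
                           (trans (cong₂ δ (sym pv-x) (inject₁-sq a a≢v)) (δ-injective pv pv-injective x a))
    misses : ∀ {e} → ends G e ≈ᵤ (c , v) → incidence G x e ≡ 0
    misses {e} ends≈ = let (a≢x , b≢x) = ≈ᵤ-avoids ends≈ x≢c x≢v in incidence-zero G x e a≢x b≢x
    deg-x : ∑[ e < E G ] incidence G x e ≡ incidence G x e1 + incidence G x e2 + 3
    deg-x = trans (sym (deg-∑ G x)) (trans (deg-3 x x≢c) (cong₂ (λ a b → a + b + 3) (sym (misses ends-e1)) (sym (misses ends-e2))))

  -- c′ carries the old edges of both c and v: (deg c - 2) + (deg v - 2) = r + 1.
  deg-c′ : deg G′ c′ ≡ suc r
  deg-c′ = begin
    deg G′ c′                                                         ≡⟨ deg-∑ G′ c′ ⟩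
    ∑[ i < E′ ] incidence G′ c′ i                                     ≡⟨ sum-cong-≗ incidence-c′ ⟩
    ∑[ i < E′ ] (incidence G c (old i) + incidence G v (old i))       ≡⟨ ∑-distrib-+ (λ i → incidence G c (old i)) (λ i → incidence G v (old i)) ⟩
    ∑[ i < E′ ] incidence G c (old i) + ∑[ i < E′ ] incidence G v (old i) ≡⟨ cong₂ _+_ (∑-old (incidence G c) deg-c-split) (∑-old (incidence G v) deg-v-split) ⟩
    r + 1                                                             ≡⟨ +-comm r 1 ⟩
    suc r                                                             ∎
    where
    open ≡-Reasoning
    δ-sq : ∀ a → δ c′ (sq (pv a)) ≡ δ c a + δ v a
    δ-sq a with a Fin.≟ v
    ... | yes refl = trans (cong (δ c′) sq-v) (trans (δ-refl c′) (sym (cong₂ _+_ (δ-≢ (≢-sym v≢c)) (δ-refl v))))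
    ... | no a≢v   = trans (sym (δ-injective inject₁ inject₁-injective c′ (sq (pv a))))
                           (trans (cong₂ δ inject₁-c′ (inject₁-sq a a≢v))
                           (trans (δ-injective pv pv-injective c a) (sym (trans (cong (δ c a +_) (δ-≢ (≢-sym a≢v))) (+-identityʳ _)))))
    incidence-c′ : ∀ i → incidence G′ c′ i ≡ incidence G c (old i) + incidence G v (old i)
    incidence-c′ i = trans (cong₂ _+_ (δ-sq a) (δ-sq b)) (interchange (δ c a) (δ v a) (δ c b) (δ v b))
      where
      a b : Fin (V G)
      a = proj₁ (ends G (old i))
      b = proj₂ (ends G (old i))
    hits : ∀ x e → (proj₁ (ends G e) ≡ x ⊎ proj₂ (ends G e) ≡ x) → incidence G x e ≡ 1
    hits x e = incidence-one G x e loopless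
    deg-c-split : ∑[ e < E G ] incidence G c e ≡ incidence G c e1 + incidence G c e2 + r
    deg-c-split = trans (sym (deg-∑ G c)) (trans deg-c (trans (cong suc V≡)
                    (cong₂ (λ a b → a + b + r) (sym (hits c e1 (≈ᵤ-has-fst ends-e1))) (sym (hits c e2 (≈ᵤ-has-fst ends-e2))))))
    deg-v-split : ∑[ e < E G ] incidence G v e ≡ incidence G v e1 + incidence G v e2 + 1
    deg-v-split = trans (sym (deg-∑ G v)) (trans (deg-3 v v≢c)
                    (cong₂ (λ a b → a + b + 1) (sym (hits v e1 (≈ᵤ-has-snd ends-e1))) (sym (hits v e2 (≈ᵤ-has-snd ends-e2)))))

  -- G′ - c′ is connected: paths of G - c map along ρ, which contracts
  -- the edge e3 (v ↦ w′) and is sq ∘ pv elsewhere.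
  ρ : Fin (V G) → Fin r
  ρ a = squash w′ (pv a)

  ρ-v : ρ v ≡ w′
  ρ-v = trans (cong (squash w′) pv-v) (squash-last w′)

  ρ-other : ∀ a → a ≢ v → ρ a ≡ sq (pv a)
  ρ-other a a≢v = squash-irrelevant w′ c′ (pv a) (pv≢last a a≢v)

  ρ-v-or-w : ∀ {a} → a ≡ v ⊎ a ≡ w → ρ a ≡ w′
  ρ-v-or-w (inj₁ refl) = ρ-v
  ρ-v-or-w (inj₂ refl) = ρ-other w w≢v

  ρ≡c′ : ∀ x → x ≢ v → ρ x ≡ c′ → x ≡ c
  ρ≡c′ x x≢v ρx≡c′ = pv-injective (trans (sym (inject₁-sq x x≢v)) (trans (cong inject₁ (trans (sym (ρ-other x x≢v)) ρx≡c′)) inject₁-c′))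

  avoids-c : ∀ {a b} e → a ≢ c → b ≢ c → (ends G e ≡ (a , b) ⊎ ends G e ≡ (b , a)) → ends G e ≈ᵤ (c , v) → ⊥
  avoids-c {a} {b} e a≢c b≢c e-joins ends≈ with ≈ᵤ-ends ends≈ e-joins
  ... | inj₁ a≡c , _         = a≢c a≡c
  ... | inj₂ _   , inj₁ b≡c  = b≢c b≡c
  ... | inj₂ refl , inj₂ refl = no-loop G loopless e e-joins

  old-step : ∀ {a b} e → (ends G e ≡ (a , b) ⊎ ends G e ≡ (b , a)) → a ≢ c → b ≢ c
    → e ≢ e1 → e ≢ e2 → e ≢ e3 → AdjAvoid G′ c′ (ρ a) (ρ b)
  old-step {a} {b} e e-joins a≢c b≢c e≢e1 e≢e2 e≢e3 = (i , joins′ e-joins) , (λ eq → a≢c (ρ≡c′ a a≢v eq)) , (λ eq → b≢c (ρ≡c′ b b≢v eq))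
    where
    i : Fin E′
    i = proj₁ (old-index e e≢e1 e≢e2)
    ends-i : ends G′ i ≡ mapPair sq (mapPair pv (ends G e))
    ends-i = cong (λ e′ → mapPair sq (mapPair pv (ends G e′))) (old-pe e i (proj₂ (old-index e e≢e1 e≢e2)))
    off-v : proj₁ (ends G e) ≢ v × proj₂ (ends G e) ≢ v
    off-v = only-three e e≢e1 e≢e2 e≢e3
    a≢v : a ≢ v
    a≢v = [ (λ eq a≡v → proj₁ off-v (trans (cong proj₁ eq) a≡v)) , (λ eq a≡v → proj₂ off-v (trans (cong proj₂ eq) a≡v)) ] e-joins
    b≢v : b ≢ v
    b≢v = [ (λ eq b≡v → proj₂ off-v (trans (cong proj₂ eq) b≡v)) , (λ eq b≡v → proj₁ off-v (trans (cong proj₁ eq) b≡v)) ] e-joins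
    joins′ : (ends G e ≡ (a , b) ⊎ ends G e ≡ (b , a)) → ends G′ i ≡ (ρ a , ρ b) ⊎ ends G′ i ≡ (ρ b , ρ a)
    joins′ (inj₁ eq) = inj₁ (trans ends-i (trans (cong (λ p → mapPair sq (mapPair pv p)) eq) (sym (cong₂ _,_ (ρ-other a a≢v) (ρ-other b b≢v)))))
    joins′ (inj₂ eq) = inj₂ (trans ends-i (trans (cong (λ p → mapPair sq (mapPair pv p)) eq) (sym (cong₂ _,_ (ρ-other b b≢v) (ρ-other a a≢v)))))

  step-image : ∀ {a b} → AdjAvoid G c a b → ρ a ≡ ρ b ⊎ AdjAvoid G′ c′ (ρ a) (ρ b)
  step-image ((e , e-joins) , a≢c , b≢c) with e Fin.≟ e1 | e Fin.≟ e2 | e Fin.≟ e3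
  ... | yes refl | _        | _        = ⊥-elim (avoids-c e a≢c b≢c e-joins ends-e1)
  ... | no _     | yes refl | _        = ⊥-elim (avoids-c e a≢c b≢c e-joins ends-e2)
  ... | no _     | no _     | yes refl = inj₁ (trans (ρ-v-or-w (proj₁ (≈ᵤ-ends ends-e3 e-joins))) (sym (ρ-v-or-w (proj₂ (≈ᵤ-ends ends-e3 e-joins)))))
  ... | no e≢e1  | no e≢e2  | no e≢e3  = inj₂ (old-step e e-joins a≢c b≢c e≢e1 e≢e2 e≢e3)

  connected-c′ : ConnectedWithout G′ c′
  connected-c′ t t′ t≢c′ t′≢c′ =
    subst₂ (Star (AdjAvoid G′ c′)) (ρ-lift t) (ρ-lift t′) (star-map ρ step-image (connected-c (lift t) (lift t′) (lift≢c t t≢c′) (lift≢c t′ t′≢c′)))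
    where
    lift : Fin r → Fin (V G)
    lift t = from πV (inject₁ t)
    ρ-lift : ∀ t → ρ (lift t) ≡ t
    ρ-lift t = trans (cong (squash w′) (to-from πV (inject₁ t))) (squash-inject₁ w′ t)
    lift≢c : ∀ t → t ≢ c′ → lift t ≢ c
    lift≢c t t≢c′ eq = t≢c′ (inject₁-injective (trans (sym (to-from πV (inject₁ t))) (trans (cong pv eq) (sym inject₁-c′))))

  hypotheses′ : Hypotheses G′ c′
  hypotheses′ = record { loopless = loopless′ ; connected-c = connected-c′ ; deg-c = deg-c′ ; deg-3 = deg-3′ }

realizable-≅ : ∀ {G H} → Realizable G → Isomorphic G H → Realizable H
realizable-≅ {G} {H} (T , twoTree , loopless , M , plane , T*≅G) G≅H =
  T , twoTree , loopless , M , plane , isomorphic-trans {dual T M} {G} {H} T*≅G G≅H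

-- The base case: with two vertices c, u all edges join c and u, and there
-- are deg u = 3 of them, so G ≅ θ.
module TwoVertices (G : MGraph) (c : Fin (V G)) (V≡2 : V G ≡ 2) (hyp : Hypotheses G c) where
  open Hypotheses hyp

  f : Fin 2 ↔ Fin (V G)
  f = ↔-trans (transpose 0F (from (cast-id (sym V≡2)) c)) (cast-id (sym V≡2))

  f-0 : to f 0F ≡ c
  f-0 = trans (cong (to (cast-id (sym V≡2))) (transpose-left 0F _)) (to-from (cast-id (sym V≡2)) c)

  u : Fin (V G)
  u = to f 1F

  u≢c : u ≢ c
  u≢c u≡c with to-injective f {1F} {0F} (trans u≡c (sym f-0))
  ... | ()

  c-or-u : ∀ x → x ≡ c ⊎ x ≡ u
  c-or-u x with from f x in eq
  ... | 0F = inj₁ (trans (sym (to-from f x)) (trans (cong (to f) eq) f-0))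
  ... | 1F = inj₂ (trans (sym (to-from f x)) (cong (to f) eq))

  joins-c-u : ∀ e → ends G e ≈ᵤ (c , u)
  joins-c-u e with c-or-u (proj₁ (ends G e)) | c-or-u (proj₂ (ends G e))
  ... | inj₁ a≡c | inj₁ b≡c = ⊥-elim (loopless e (trans a≡c (sym b≡c)))
  ... | inj₂ a≡u | inj₂ b≡u = ⊥-elim (loopless e (trans a≡u (sym b≡u)))
  ... | inj₁ a≡c | inj₂ b≡u = inj₁ (trans (pair-η _) (cong₂ _,_ a≡c b≡u))
  ... | inj₂ a≡u | inj₁ b≡c = inj₂ (trans (pair-η _) (cong₂ _,_ a≡u b≡c))

  three-edges : E G ≡ 3
  three-edges = begin
    E G                             ≡⟨ sym (∑-const-1 (E G)) ⟩
    ∑[ e < E G ] 1                  ≡⟨ sum-cong-≗ (λ e → sym (incidence-one G u e loopless (≈ᵤ-has-snd (joins-c-u e)))) ⟩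
    ∑[ e < E G ] incidence G u e    ≡⟨ sym (deg-∑ G u) ⟩
    deg G u                         ≡⟨ deg-3 u u≢c ⟩
    3                               ∎
    where open ≡-Reasoning

  θ≅G : Isomorphic θ G
  θ≅G = f , cast-id (sym three-edges) , λ e → ≈ᵤ-trans (joins-c-u _) (θ-edge e)
    where
    θ-edge : ∀ e → (c , u) ≈ᵤ mapPair (to f) (ends θ e)
    θ-edge 0F = inj₁ (cong₂ _,_ (sym f-0) refl)
    θ-edge 1F = inj₁ (cong₂ _,_ (sym f-0) refl)
    θ-edge 2F = inj₂ (cong₂ _,_ (sym f-0) refl)

  realizable : Realizable G
  realizable = realizable-≅ {θ} {G} realizable-θ θ≅G

realizable-from-hypotheses : ∀ n (G : MGraph) (c : Fin (V G)) → V G ≡ 2 + n → Hypotheses G c → Realizable G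
realizable-from-hypotheses zero    G c V≡ hyp = TwoVertices.realizable G c V≡ hyp
realizable-from-hypotheses (suc n) G c V≡ hyp =
  realizable-≅ {G⁺} {G} (realizable-subdivideDouble G′ (realizable-from-hypotheses n G′ c′ refl hypotheses′) j sG)
               (isomorphic-sym {G} {G⁺} G≅G⁺)
  where
  open Reduce G c n V≡ hyp (FindLeaf.leaf G c n V≡ hyp)

lemma5p2 : (G : MGraph) → Loopless G → TwoConnected G
    → (Σ (Fin (V G)) λ c → deg G c ≡ suc (V G) × (∀ v → v ≢ c → deg G v ≡ 3))
    → ∃[ T ] (TwoTree T × IsPlanarDualOf G T)
lemma5p2 G loopless (2≤V , _ , connected-without) (c , deg-c , deg-3)
  with realizable-from-hypotheses (V G ∸ 2) G c V≡ hyp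
  where
  V≡ : V G ≡ 2 + (V G ∸ 2)
  V≡ = sym (trans (+-comm 2 (V G ∸ 2)) (m∸n+n≡m 2≤V))
  hyp : Hypotheses G c
  hyp = record { loopless = loopless ; connected-c = connected-without c ; deg-c = deg-c ; deg-3 = deg-3 }
... | T , twoTree , _ , M , plane , T*≅G = T , twoTree , M , plane , isomorphic⇒Iso {dual T M} {G} T*≅G
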